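{- Let $G = (V,E)$ be a $d$-regular $n$-vertex graph, let $\ell \in \mathbb{N}^+$, let $w: E \to \{\pm1\}$ be an edge-signing with non-backtracking matrix $B$, and define $T = \mathrm{tr}(B^\ell (B^\top)^\ell)$ (which is an upper bound on $\rho(B)^{2\ell}$). Then for a uniformly random edge-signing $\mathbf{w}$, $$\mathbb{E}[\mathbf{T}] \leq d^2 \cdot \#\{\text{even } (\ell-1)\text{ -hikes in } G\} \leq d^2 \cdot \#\{\text{singleton-free } (\ell-1)\text{ -hikes in } G\}.$$ Furthermore, if $\mathbf{w}$ is merely $(\delta,2\ell)$-wise uniform, the bound holds up to an additive $\delta n d^{2\ell+2}$.
   Context: For an edge-signing $w$, the signed adjacency matrix $A$ has $A_{uv}=A_{vu}=w(u,v)$ on edges, and the non-backtracking matrix $B$, indexed by directed edges, has $B_{(u_1,v_1),(u_2,v_2)} = A_{u_2,v_2}$ if $v_1 = u_2$ and $v_2 \neq u_1$, and $0$ otherwise; $\rho$ denotes spectral radius. For $\ell \in \mathbb{N}$, an $\ell$-hike is a closed walk in $G$ of exactly $2\ell$ steps which is non-backtracking (no step is the reverse of the preceding step) except possibly between the $\ell$th and $(\ell+1)$th steps. A hike is even if every undirected edge it traverses is traversed an even number of times, and singleton-free if every undirected edge it traverses is traversed at least twice. A sequence of $\{\pm1\}$-valued random variables is $(\delta,k)$-wise uniform if every product of between $1$ and $k$ of them has expectation of absolute value at most $\delta$.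
   Formalization: The parameter δ and the probability masses of the (δ,2ℓ)-wise uniform random edge-signing are rational. -}

module Defs where

open import Data.Bool using (Bool; true; false; if_then_else_; _∧_; _∨_; not)
open import Data.Nat as ℕ using (ℕ; zero; suc; _<ᵇ_; _≡ᵇ_)
open import Data.Nat.Properties using (m^n≢0)
open import Data.Fin as Fin using (Fin; toℕ)
open import Data.Fin.Subset using (Subset)
open import Data.Integer as ℤ using (ℤ; +_; -[1+_])
open import Data.Rational as ℚ using (ℚ; 0ℚ; 1ℚ; _/_)
open import Data.List as List using (List; []; _∷_; length; filterᵇ; allFin; concatMap; map; foldr; lookup)
open import Data.Vec as Vec using (Vec; []; _∷_)
open import Data.Product using (_×_; _,_; proj₁; proj₂)
open import Relation.Binary.PropositionalEquality using (_≡_)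
open import Relation.Nullary.Decidable using (⌊_⌋)

record Graph (n : ℕ) : Set where
  field
    adj    : Fin n → Fin n → Bool
    sym    : ∀ u v → adj u v ≡ adj v u
    irrefl : ∀ u → adj u u ≡ false
open Graph public

_==_ : ∀ {n} → Fin n → Fin n → Bool
u == v = ⌊ u Fin.≟ v ⌋

countᵇ : ∀ {A : Set} → (A → Bool) → List A → ℕ
countᵇ p xs = length (filterᵇ p xs)

degree : ∀ {n} → Graph n → Fin n → ℕ
degree G u = countᵇ (adj G u) (allFin _)

Regular : ∀ {n} → Graph n → ℕ → Set
Regular G d = ∀ u → degree G u ≡ d

allPairs : (n : ℕ) → List (Fin n × Fin n)
allPairs n = concatMap (λ u → map (λ v → (u , v)) (allFin n)) (allFin n)

edgeList : ∀ {n} → Graph n → List (Fin n × Fin n)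
edgeList {n} G = filterᵇ (λ p → (toℕ (proj₁ p) <ᵇ toℕ (proj₂ p)) ∧ adj G (proj₁ p) (proj₂ p)) (allPairs n)

numEdges : ∀ {n} → Graph n → ℕ
numEdges G = length (edgeList G)

edge : ∀ {n} (G : Graph n) → Fin (numEdges G) → Fin n × Fin n
edge G = lookup (edgeList G)

dirEdgeList : ∀ {n} → Graph n → List (Fin n × Fin n)
dirEdgeList {n} G = filterᵇ (λ p → adj G (proj₁ p) (proj₂ p)) (allPairs n)

numDirEdges : ∀ {n} → Graph n → ℕ
numDirEdges G = length (dirEdgeList G)

dirEdge : ∀ {n} (G : Graph n) → Fin (numDirEdges G) → Fin n × Fin n
dirEdge G = lookup (dirEdgeList G)

∑ : ∀ {k} → (Fin k → ℤ) → ℤ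
∑ {zero}  f = + 0
∑ {suc k} f = f Fin.zero ℤ.+ ∑ (λ i → f (Fin.suc i))

∏ : ∀ {k} → (Fin k → ℤ) → ℤ
∏ {zero}  f = + 1
∏ {suc k} f = f Fin.zero ℤ.* ∏ (λ i → f (Fin.suc i))

-- Edge-signings w : E → {±1}; a signing is a vector of signs indexed by
-- the edges (true ↦ +1, false ↦ -1).

Signing : ∀ {n} → Graph n → Set
Signing G = Vec Bool (numEdges G)

sgn : Bool → ℤ
sgn true  = + 1
sgn false = -[1+ 0 ]

wt : ∀ {n} (G : Graph n) → Signing G → Fin (numEdges G) → ℤ
wt G w e = sgn (Vec.lookup w e)

signedAdj : ∀ {n} (G : Graph n) → Signing G → Fin n → Fin n → ℤ
signedAdj G w u v = ∑ (λ e →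
  let (a , b) = edge G e in
  if (a == u ∧ b == v) ∨ (a == v ∧ b == u) then wt G w e else + 0)

Mat : ℕ → Set
Mat k = Fin k → Fin k → ℤ

_⊗_ : ∀ {k} → Mat k → Mat k → Mat k
(M ⊗ N) i j = ∑ (λ t → M i t ℤ.* N t j)

idMat : ∀ {k} → Mat k
idMat i j = if i == j then + 1 else + 0

_^^_ : ∀ {k} → Mat k → ℕ → Mat k
M ^^ zero  = idMat
M ^^ suc e = M ⊗ (M ^^ e)

transpose : ∀ {k} → Mat k → Mat k
transpose M i j = M j i

trace : ∀ {k} → Mat k → ℤ
trace M = ∑ (λ i → M i i)

nbMatrix : ∀ {n} (G : Graph n) → Signing G → Mat (numDirEdges G)
nbMatrix G w i j =
  let (u₁ , v₁) = dirEdge G i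
      (u₂ , v₂) = dirEdge G j
  in if (v₁ == u₂) ∧ not (v₂ == u₁) then signedAdj G w u₂ v₂ else + 0

Tval : ∀ {n} (G : Graph n) → ℕ → Signing G → ℤ
Tval G ℓ w = let B = nbMatrix G w in trace ((B ^^ ℓ) ⊗ (transpose B ^^ ℓ))

-- Probability distributions on signings (finite space {±1}^E),
-- given by (rational) point masses.

allVecs : ∀ {A : Set} → List A → (m : ℕ) → List (Vec A m)
allVecs xs zero    = Vec.[] ∷ []
allVecs xs (suc m) = concatMap (λ x → map (x Vec.∷_) (allVecs xs m)) xs

allSignings : ∀ {n} (G : Graph n) → List (Signing G)
allSignings G = allVecs (true ∷ false ∷ []) (numEdges G)

sumℚ : List ℚ → ℚ
sumℚ = foldr ℚ._+_ 0ℚ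

toℚ : ℤ → ℚ
toℚ z = z / 1

ℕtoℚ : ℕ → ℚ
ℕtoℚ k = toℚ (+ k)

𝔼 : ∀ {n} (G : Graph n) → (Signing G → ℚ) → (Signing G → ℤ) → ℚ
𝔼 G p f = sumℚ (map (λ w → p w ℚ.* toℚ (f w)) (allSignings G))

IsDistribution : ∀ {n} (G : Graph n) → (Signing G → ℚ) → Set
IsDistribution G p = (∀ w → 0ℚ ℚ.≤ p w) × (sumℚ (map p (allSignings G)) ≡ 1ℚ)

uniform : ∀ {n} (G : Graph n) → Signing G → ℚ
uniform G w = (+ 1 / (2 ℕ.^ numEdges G)) {{m^n≢0 2 (numEdges G)}}

prodOver : ∀ {n} (G : Graph n) → Subset (numEdges G) → Signing G → ℤ
prodOver G S w = ∏ (λ e → if Vec.lookup S e then wt G w e else + 1)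

WiseUniform : ∀ {n} (G : Graph n) → (Signing G → ℚ) → ℚ → ℕ → Set
WiseUniform G p δ k =
  (S : Subset (numEdges G)) → 1 ℕ.≤ Data.Fin.Subset.∣ S ∣ → Data.Fin.Subset.∣ S ∣ ℕ.≤ k →
  ℚ.∣ 𝔼 G p (prodOver G S) ∣ ℚ.≤ δ

-- Hikes.  A closed walk of 2k steps is a vertex sequence v₀ … v_{2k}.

Walk : ℕ → ℕ → Set
Walk n k = Vec (Fin n) (suc (2 ℕ.* k))

steps : ∀ {n} → List (Fin n) → List (Fin n × Fin n)
steps (x ∷ y ∷ xs) = (x , y) ∷ steps (y ∷ xs)
steps _            = []

stepEq : ∀ {n} → Fin n × Fin n → Fin n × Fin n → Bool
stepEq (a , b) (c , d) = (a == c) ∧ (b == d)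

-- no step is the reverse of the preceding step, except between the
-- k-th and (k+1)-th steps; i is the (1-based) index of the first step
nbExcept : ∀ {n} → ℕ → ℕ → List (Fin n × Fin n) → Bool
nbExcept k i (s ∷ t ∷ rest) =
  ((i ≡ᵇ k) ∨ not (stepEq t (proj₂ s , proj₁ s))) ∧ nbExcept k (suc i) (t ∷ rest)
nbExcept k i _ = true

allᵇ : ∀ {A : Set} → (A → Bool) → List A → Bool
allᵇ p = foldr (λ x b → p x ∧ b) true

isHike : ∀ {n} → Graph n → (k : ℕ) → Walk n k → Bool
isHike G k v =
  let ss = steps (Vec.toList v) in
  (Vec.head v == Vec.last v)
  ∧ allᵇ (λ s → adj G (proj₁ s) (proj₂ s)) ss
  ∧ nbExcept k 1 ss

traversals : ∀ {n} → Fin n → Fin n → List (Fin n × Fin n) → ℕ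
traversals a b = countᵇ (λ s → stepEq s (a , b) ∨ stepEq s (b , a))

isEvenℕ : ℕ → Bool
isEvenℕ zero          = true
isEvenℕ (suc zero)    = false
isEvenℕ (suc (suc m)) = isEvenℕ m

isEvenWalk : ∀ {n} → (k : ℕ) → Walk n k → Bool
isEvenWalk {n} k v =
  allᵇ (λ p → isEvenℕ (traversals (proj₁ p) (proj₂ p) (steps (Vec.toList v)))) (allPairs n)

isSingletonFreeWalk : ∀ {n} → (k : ℕ) → Walk n k → Bool
isSingletonFreeWalk {n} k v =
  allᵇ (λ p → not (traversals (proj₁ p) (proj₂ p) (steps (Vec.toList v)) ≡ᵇ 1)) (allPairs n)

allWalks : (n k : ℕ) → List (Walk n k)
allWalks n k = allVecs (allFin n) (suc (2 ℕ.* k))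

numEvenHikes : ∀ {n} → Graph n → ℕ → ℕ
numEvenHikes {n} G k = countᵇ (λ v → isHike G k v ∧ isEvenWalk k v) (allWalks n k)

numSingletonFreeHikes : ∀ {n} → Graph n → ℕ → ℕ
numSingletonFreeHikes {n} G k = countᵇ (λ v → isHike G k v ∧ isSingletonFreeWalk k v) (allWalks n k)

-- Expanding tr(B^ℓ (Bᵀ)^ℓ) entry by entry writes T as a sum, over paths that start with an
-- arc a → b, go ℓ non-backtracking steps forward and come back along ℓ non-backtracking
-- steps to close up at that arc, of the product of the signs of the traversed edges. Such a
-- path is an arc a → b, an (ℓ−1)-hike from b, and a detour y → z → y at the turning point of
-- the hike, so each hike carries d² paths, and since the detour edge is crossed twice the
-- path crosses every edge with the parity of the hike. The sign product of a path is 1 when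
-- all crossing numbers are even; otherwise it is a product of at most 2ℓ distinct edge signs,
-- whose mean vanishes for a uniform signing and is at most δ for a (δ,2ℓ)-wise uniform one,
-- and there are at most d² · n d^(2ℓ−2) paths in all. Even hikes are singleton-free.
module Submission where

module NonBacktrackingTrace where

  open import Data.Bool using (Bool; true; false; if_then_else_; _∧_; _∨_; not)
  import Data.Bool.Properties as BP
  open import Data.Empty using (⊥-elim)
  open import Data.Fin as F using (Fin; toℕ)
  import Data.Fin.Properties as FP
  open import Data.Fin.Subset using (Subset; ∣_∣; ⁅_⁆)
  import Data.Fin.Subset.Properties as SubP
  open import Data.Integer as ℤ using (ℤ; +_; -[1+_]; _+_; _*_; _≤_)
  import Data.Integer.Properties as ℤP
  open import Algebra.Properties.AbelianGroup ℤP.+-0-abelianGroup using () renaming (∙-cancelˡ to +-cancelˡ)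
  open import Algebra.Properties.CommutativeSemigroup ℤP.+-commutativeSemigroup
    using () renaming (interchange to +-interchange)
  open import Algebra.Properties.CommutativeSemigroup ℤP.*-commutativeSemigroup
    using () renaming (x∙yz≈y∙xz to *-exchangeˡ; interchange to *-interchange)
  open import Data.Integer.Tactic.RingSolver using (solve-∀)
  open import Data.List as L using (List; []; _∷_; _++_)
  import Data.List.Properties as LP
  open import Data.Nat as ℕ using (ℕ; zero; suc; _<ᵇ_; _≡ᵇ_)
  import Data.Nat.Coprimality as Cop
  import Data.Nat.Properties as ℕP
  import Data.Nat.Tactic.RingSolver as ℕ-Solver
  open import Data.Product using (_×_; _,_; proj₁; proj₂; Σ; swap)
  open import Data.Rational as ℚ using (ℚ; 0ℚ; 1ℚ)
  import Data.Rational.Properties as ℚP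
  open import Data.Rational.Solver using (module +-*-Solver)
  import Data.Rational.Unnormalised as ℚᵘ
  import Data.Rational.Unnormalised.Properties as ℚᵘP
  open import Data.Sum using (_⊎_; inj₁; inj₂)
  open import Data.Vec as V using (Vec; []; _∷_)
  import Data.Vec.Properties as VP
  open import Defs hiding (sym)
  open import Function using (_∘_; id)
  open import Function.Bundles using (Equivalence)
  open import Relation.Binary using (tri<; tri≈; tri>)
  open import Relation.Binary.PropositionalEquality
  open import Relation.Nullary using (¬_; yes; no)

  -- Finite sums and matrix powers

  𝟙 : Bool → ℤ
  𝟙 true = + 1
  𝟙 false = + 0

  𝟙-∧ : ∀ x y → 𝟙 (x ∧ y) ≡ 𝟙 x * 𝟙 y
  𝟙-∧ true y = sym (ℤP.*-identityˡ (𝟙 y))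
  𝟙-∧ false y = refl

  𝟙-nonneg : ∀ b → + 0 ≤ 𝟙 b
  𝟙-nonneg true = ℤ.+≤+ ℕ.z≤n
  𝟙-nonneg false = ℤ.+≤+ ℕ.z≤n

  𝟙≤1 : ∀ b → 𝟙 b ≤ + 1
  𝟙≤1 true = ℤP.≤-refl
  𝟙≤1 false = ℤ.+≤+ ℕ.z≤n

  𝟙*𝟙-nonneg : ∀ a b → + 0 ≤ 𝟙 a * 𝟙 b
  𝟙*𝟙-nonneg a b = subst (+ 0 ≤_) (𝟙-∧ a b) (𝟙-nonneg (a ∧ b))

  𝟙*-mono-≤ : ∀ c {x y} → x ≤ y → 𝟙 c * x ≤ 𝟙 c * y
  𝟙*-mono-≤ c = ℤP.*-monoˡ-≤-nonNeg (𝟙 c) {{ℤ.nonNegative (𝟙-nonneg c)}}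

  ∧-true⁻ : ∀ {a b} → (a ∧ b) ≡ true → a ≡ true × b ≡ true
  ∧-true⁻ {true} {true} _ = refl , refl

  ∧-true⁺ : ∀ {a b} → a ≡ true → b ≡ true → (a ∧ b) ≡ true
  ∧-true⁺ refl refl = refl

  ∨-true⁻ : ∀ {a b} → (a ∨ b) ≡ true → (a ≡ true) ⊎ (b ≡ true)
  ∨-true⁻ {true} _ = inj₁ refl
  ∨-true⁻ {false} h = inj₂ h

  Bool-ext : ∀ {b c : Bool} → (b ≡ true → c ≡ true) → (c ≡ true → b ≡ true) → b ≡ c
  Bool-ext {true} {true} f g = refl
  Bool-ext {true} {false} f g = sym (f refl)
  Bool-ext {false} {true} f g = g refl
  Bool-ext {false} {false} f g = refl

  ==-refl : ∀ {n} (i : Fin n) → (i == i) ≡ true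
  ==-refl i with i F.≟ i
  ... | yes _ = refl
  ... | no i≢i = ⊥-elim (i≢i refl)

  ==-≢ : ∀ {n} (i j : Fin n) → ¬ (i ≡ j) → (i == j) ≡ false
  ==-≢ i j i≢j with i F.≟ j
  ... | yes i≡j = ⊥-elim (i≢j i≡j)
  ... | no _ = refl

  ==⇒≡ : ∀ {n} (i j : Fin n) → (i == j) ≡ true → i ≡ j
  ==⇒≡ i j h with i F.≟ j
  ... | yes i≡j = i≡j
  ==⇒≡ i j () | no _

  ==-sym : ∀ {n} (i j : Fin n) → (i == j) ≡ (j == i)
  ==-sym i j = Bool-ext (λ h → subst (λ k → (j == k) ≡ true) (sym (==⇒≡ i j h)) (==-refl j))
                        (λ h → subst (λ k → (i == k) ≡ true) (sym (==⇒≡ j i h)) (==-refl i))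

  ∑-cong : ∀ {k} {f g : Fin k → ℤ} → (∀ i → f i ≡ g i) → ∑ f ≡ ∑ g
  ∑-cong {zero} h = refl
  ∑-cong {suc k} h = cong₂ _+_ (h F.zero) (∑-cong (λ i → h (F.suc i)))

  ∑-distrib-+ : ∀ {k} (f g : Fin k → ℤ) → ∑ (λ i → f i + g i) ≡ ∑ f + ∑ g
  ∑-distrib-+ {zero} f g = refl
  ∑-distrib-+ {suc k} f g =
    trans (cong (_+_ (f F.zero + g F.zero)) (∑-distrib-+ (λ i → f (F.suc i)) (λ i → g (F.suc i))))
          (+-interchange (f F.zero) (g F.zero) _ _)

  ∑-*ˡ : ∀ {k} (c : ℤ) (f : Fin k → ℤ) → ∑ (λ i → c * f i) ≡ c * ∑ f
  ∑-*ˡ {zero} c f = sym (ℤP.*-zeroʳ c)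
  ∑-*ˡ {suc k} c f = trans (cong (_+_ (c * f F.zero)) (∑-*ˡ c (λ i → f (F.suc i))))
                          (sym (ℤP.*-distribˡ-+ c (f F.zero) _))

  ∑-*ʳ : ∀ {k} (c : ℤ) (f : Fin k → ℤ) → ∑ (λ i → f i * c) ≡ ∑ f * c
  ∑-*ʳ c f = trans (∑-cong (λ i → ℤP.*-comm (f i) c)) (trans (∑-*ˡ c f) (ℤP.*-comm c _))

  ∑-const : ∀ {k} (c : ℤ) → ∑ {k} (λ _ → c) ≡ + k * c
  ∑-const {zero} c = refl
  ∑-const {suc k} c = trans (cong (_+_ c) (∑-const {k} c)) (sym (ℤP.suc-* (+ k) c))

  ∑-zero : ∀ {k} → ∑ {k} (λ _ → + 0) ≡ + 0
  ∑-zero {k} = trans (∑-const {k} (+ 0)) (ℤP.*-zeroʳ (+ k))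

  ∑-comm : ∀ {k l} (f : Fin k → Fin l → ℤ) → ∑ (λ i → ∑ (λ j → f i j)) ≡ ∑ (λ j → ∑ (λ i → f i j))
  ∑-comm {zero} {l} f = sym (∑-zero {l})
  ∑-comm {suc k} f = trans (cong (_+_ (∑ (f F.zero))) (∑-comm (λ i → f (F.suc i))))
                          (sym (∑-distrib-+ (f F.zero) (λ j → ∑ (λ i → f (F.suc i) j))))

  ∑-single : ∀ {k} (x : Fin k) (f : Fin k → ℤ) → (∀ i → ¬ (i ≡ x) → f i ≡ + 0) → ∑ f ≡ f x
  ∑-single {suc k} F.zero f off = begin
    f F.zero + ∑ (λ i → f (F.suc i)) ≡⟨ cong (_+_ (f F.zero)) (∑-cong (λ i → off (F.suc i) (λ ()))) ⟩
    f F.zero + ∑ {k} (λ _ → + 0)     ≡⟨ cong (_+_ (f F.zero)) (∑-zero {k}) ⟩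
    f F.zero + + 0                   ≡⟨ ℤP.+-identityʳ _ ⟩
    f F.zero                         ∎
    where open ≡-Reasoning
  ∑-single {suc k} (F.suc x) f off = begin
    f F.zero + ∑ (λ i → f (F.suc i)) ≡⟨ cong (_+ ∑ (λ i → f (F.suc i))) (off F.zero (λ ())) ⟩
    + 0 + ∑ (λ i → f (F.suc i))      ≡⟨ ℤP.+-identityˡ _ ⟩
    ∑ (λ i → f (F.suc i))            ≡⟨ ∑-single x _ (λ i i≢x → off (F.suc i) (i≢x ∘ FP.suc-injective)) ⟩
    f (F.suc x)                      ∎
    where open ≡-Reasoning

  ∑-mono-≤ : ∀ {k} {f g : Fin k → ℤ} → (∀ i → f i ≤ g i) → ∑ f ≤ ∑ g
  ∑-mono-≤ {zero} h = ℤP.≤-refl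
  ∑-mono-≤ {suc k} h = ℤP.+-mono-≤ (h F.zero) (∑-mono-≤ (λ i → h (F.suc i)))

  ∑𝟙-nonneg : ∀ {k} (P : Fin k → Bool) → + 0 ≤ ∑ (λ e → 𝟙 (P e))
  ∑𝟙-nonneg {k} P = subst (_≤ ∑ (λ e → 𝟙 (P e))) (∑-zero {k}) (∑-mono-≤ (λ e → 𝟙-nonneg (P e)))

  ∑𝟙≡0⇒false : ∀ {k} (P : Fin k → Bool) → ∑ (λ e → 𝟙 (P e)) ≡ + 0 → ∀ e → P e ≡ false
  ∑𝟙≡0⇒false {suc k} P h e with P F.zero in eq
  ∑𝟙≡0⇒false {suc k} P h e | true
    with subst (+ 1 ≤_) h (ℤP.+-mono-≤ (ℤP.≤-refl {+ 1}) (∑𝟙-nonneg (λ e → P (F.suc e))))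
  ... | ℤ.+≤+ ()
  ∑𝟙≡0⇒false {suc k} P h F.zero | false = eq
  ∑𝟙≡0⇒false {suc k} P h (F.suc e) | false =
    ∑𝟙≡0⇒false (λ e → P (F.suc e)) (trans (sym (ℤP.+-identityˡ _)) h) e

  ∑𝟙≡1⇒unique : ∀ {k} (P : Fin k → Bool) → ∑ (λ e → 𝟙 (P e)) ≡ + 1 →
    Σ (Fin k) (λ e → P e ≡ true × (∀ e′ → P e′ ≡ true → e′ ≡ e))
  ∑𝟙≡1⇒unique {suc k} P h with P F.zero in eq
  ... | true = F.zero , eq , unique
    where
    rest≡0 : ∑ (λ e → 𝟙 (P (F.suc e))) ≡ + 0
    rest≡0 = +-cancelˡ (+ 1) _ (+ 0) (trans h (sym (ℤP.+-identityʳ (+ 1))))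
    unique : ∀ e′ → P e′ ≡ true → e′ ≡ F.zero
    unique F.zero _ = refl
    unique (F.suc e′) pe′ with trans (sym pe′) (∑𝟙≡0⇒false (λ e → P (F.suc e)) rest≡0 e′)
    ... | ()
  ... | false with ∑𝟙≡1⇒unique (λ e → P (F.suc e)) (trans (sym (ℤP.+-identityˡ _)) h)
  ... | e , pe , u = F.suc e , pe , unique
    where
    unique : ∀ e′ → P e′ ≡ true → e′ ≡ F.suc e
    unique F.zero pe′ with trans (sym pe′) eq
    ... | ()
    unique (F.suc e′) pe′ = cong F.suc (u e′ pe′)

  ∏-cong : ∀ {k} {f g : Fin k → ℤ} → (∀ i → f i ≡ g i) → ∏ f ≡ ∏ g
  ∏-cong {zero} _ = refl
  ∏-cong {suc k} h = cong₂ _*_ (h F.zero) (∏-cong (λ i → h (F.suc i)))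

  ∏-ones : ∀ {k} (f : Fin k → ℤ) → (∀ e → f e ≡ + 1) → ∏ f ≡ + 1
  ∏-ones {zero} f h = refl
  ∏-ones {suc k} f h = cong₂ _*_ (h F.zero) (∏-ones (λ i → f (F.suc i)) (λ i → h (F.suc i)))

  ∏-scale-at : ∀ {k} (f g : Fin k → ℤ) (e₀ : Fin k) (c : ℤ) →
    g e₀ ≡ c * f e₀ → (∀ e → ¬ (e ≡ e₀) → g e ≡ f e) → ∏ g ≡ c * ∏ f
  ∏-scale-at {suc k} f g F.zero c at off = begin
    g F.zero * ∏ (λ i → g (F.suc i))       ≡⟨ cong₂ _*_ at (∏-cong (λ i → off (F.suc i) (λ ()))) ⟩
    (c * f F.zero) * ∏ (λ i → f (F.suc i)) ≡⟨ ℤP.*-assoc c _ _ ⟩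
    c * ∏ f                                ∎
    where open ≡-Reasoning
  ∏-scale-at {suc k} f g (F.suc e₀) c at off = begin
    g F.zero * ∏ (λ i → g (F.suc i))       ≡⟨ cong₂ _*_ (off F.zero (λ ())) rest ⟩
    f F.zero * (c * ∏ (λ i → f (F.suc i))) ≡⟨ *-exchangeˡ (f F.zero) c _ ⟩
    c * ∏ f                                ∎
    where
    open ≡-Reasoning
    rest : ∏ (λ i → g (F.suc i)) ≡ c * ∏ (λ i → f (F.suc i))
    rest = ∏-scale-at (λ i → f (F.suc i)) (λ i → g (F.suc i)) e₀ c at
                      (λ e e≢e₀ → off (F.suc e) (e≢e₀ ∘ FP.suc-injective))

  sumList : List ℤ → ℤ
  sumList = L.foldr _+_ (+ 0)

  sumList-cong : ∀ {A : Set} {h g : A → ℤ} → (∀ x → h x ≡ g x) → ∀ xs → sumList (L.map h xs) ≡ sumList (L.map g xs)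
  sumList-cong eq [] = refl
  sumList-cong eq (x ∷ xs) = cong₂ _+_ (eq x) (sumList-cong eq xs)

  sumList-lookup : ∀ {A : Set} (xs : List A) (h : A → ℤ) →
    ∑ {L.length xs} (λ t → h (L.lookup xs t)) ≡ sumList (L.map h xs)
  sumList-lookup [] h = refl
  sumList-lookup (x ∷ xs) h = cong (_+_ (h x)) (sumList-lookup xs h)

  sumList-filter : ∀ {A : Set} (p : A → Bool) (h : A → ℤ) xs →
    sumList (L.map h (L.filterᵇ p xs)) ≡ sumList (L.map (λ x → 𝟙 (p x) * h x) xs)
  sumList-filter p h [] = refl
  sumList-filter p h (x ∷ xs) with p x
  ... | true = cong₂ _+_ (sym (ℤP.*-identityˡ (h x))) (sumList-filter p h xs)
  ... | false = trans (sumList-filter p h xs) (sym (ℤP.+-identityˡ _))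

  sumList-++ : ∀ {A : Set} (h : A → ℤ) xs ys →
    sumList (L.map h (xs ++ ys)) ≡ sumList (L.map h xs) + sumList (L.map h ys)
  sumList-++ h [] ys = sym (ℤP.+-identityˡ _)
  sumList-++ h (x ∷ xs) ys = trans (cong (_+_ (h x)) (sumList-++ h xs ys)) (sym (ℤP.+-assoc (h x) _ _))

  sumList-concatMap : ∀ {A B : Set} (h : B → ℤ) (f : A → List B) xs →
    sumList (L.map h (L.concatMap f xs)) ≡ sumList (L.map (λ x → sumList (L.map h (f x))) xs)
  sumList-concatMap h f [] = refl
  sumList-concatMap h f (x ∷ xs) =
    trans (sumList-++ h (f x) (L.concatMap f xs)) (cong (_+_ (sumList (L.map h (f x)))) (sumList-concatMap h f xs))

  sumList-map : ∀ {A B : Set} (h : B → ℤ) (f : A → B) xs →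
    sumList (L.map h (L.map f xs)) ≡ sumList (L.map (λ x → h (f x)) xs)
  sumList-map h f [] = refl
  sumList-map h f (x ∷ xs) = cong (_+_ (h (f x))) (sumList-map h f xs)

  sumList-tabulate : ∀ {A : Set} {k} (h : A → ℤ) (f : Fin k → A) → sumList (L.map h (L.tabulate f)) ≡ ∑ (h ∘ f)
  sumList-tabulate {k = zero} h f = refl
  sumList-tabulate {k = suc k} h f = cong (_+_ (h (f F.zero))) (sumList-tabulate h (f ∘ F.suc))

  sumList-allFin : ∀ {k} (h : Fin k → ℤ) → sumList (L.map h (L.allFin k)) ≡ ∑ h
  sumList-allFin h = sumList-tabulate h id

  sumList-allPairs : ∀ {n} (h : Fin n × Fin n → ℤ) →
    sumList (L.map h (allPairs n)) ≡ ∑ (λ a → ∑ (λ b → h (a , b)))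
  sumList-allPairs {n} h = begin
    sumList (L.map h (allPairs n))
      ≡⟨ sumList-concatMap h (λ a → L.map (a ,_) (L.allFin n)) (L.allFin n) ⟩
    sumList (L.map (λ a → sumList (L.map h (L.map (a ,_) (L.allFin n)))) (L.allFin n))
      ≡⟨ sumList-cong (λ a → trans (sumList-map h (a ,_) (L.allFin n)) (sumList-allFin (λ b → h (a , b)))) (L.allFin n) ⟩
    sumList (L.map (λ a → ∑ (λ b → h (a , b))) (L.allFin n))
      ≡⟨ sumList-allFin (λ a → ∑ (λ b → h (a , b))) ⟩
    ∑ (λ a → ∑ (λ b → h (a , b))) ∎
    where open ≡-Reasoning

  ∑-dirEdge : ∀ {n} (G : Graph n) (h : Fin n × Fin n → ℤ) →
    ∑ {numDirEdges G} (λ t → h (dirEdge G t)) ≡ ∑ (λ a → ∑ (λ b → 𝟙 (adj G a b) * h (a , b)))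
  ∑-dirEdge {n} G h = begin
    ∑ (λ t → h (dirEdge G t))                              ≡⟨ sumList-lookup (dirEdgeList G) h ⟩
    sumList (L.map h (dirEdgeList G))                      ≡⟨ sumList-filter isArc h (allPairs n) ⟩
    sumList (L.map (λ p → 𝟙 (isArc p) * h p) (allPairs n)) ≡⟨ sumList-allPairs (λ p → 𝟙 (isArc p) * h p) ⟩
    ∑ (λ a → ∑ (λ b → 𝟙 (adj G a b) * h (a , b)))          ∎
    where
    open ≡-Reasoning
    isArc : Fin n × Fin n → Bool
    isArc p = adj G (proj₁ p) (proj₂ p)

  mulVec : ∀ {k} → Mat k → (Fin k → ℤ) → Fin k → ℤ
  mulVec M g i = ∑ (λ t → M i t * g t)

  mulVec^ : ∀ {k} → Mat k → ℕ → (Fin k → ℤ) → Fin k → ℤ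
  mulVec^ M zero g = g
  mulVec^ M (suc e) g = mulVec M (mulVec^ M e g)

  mulVec-cong : ∀ {k} (M : Mat k) {g h : Fin k → ℤ} → (∀ t → g t ≡ h t) →
    ∀ i → mulVec M g i ≡ mulVec M h i
  mulVec-cong M eq i = ∑-cong (λ t → cong (M i t *_) (eq t))

  mulVec^-cong : ∀ {k} (M : Mat k) e {g h : Fin k → ℤ} → (∀ t → g t ≡ h t) →
    ∀ i → mulVec^ M e g i ≡ mulVec^ M e h i
  mulVec^-cong M zero eq i = eq i
  mulVec^-cong M (suc e) eq i = mulVec-cong M (mulVec^-cong M e eq) i

  mulVec^-suc : ∀ {k} (M : Mat k) e g i → mulVec^ M (suc e) g i ≡ mulVec^ M e (mulVec M g) i
  mulVec^-suc M zero g i = refl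
  mulVec^-suc M (suc e) g i = mulVec-cong M (mulVec^-suc M e g) i

  idMat-diag : ∀ {k} (i : Fin k) → idMat i i ≡ + 1
  idMat-diag i rewrite ==-refl i = refl

  idMat-off : ∀ {k} (i j : Fin k) → ¬ (i ≡ j) → idMat i j ≡ + 0
  idMat-off i j i≢j rewrite ==-≢ i j i≢j = refl

  ∑-idMat-* : ∀ {k} (f : Fin k → ℤ) (i : Fin k) → ∑ (λ t → idMat i t * f t) ≡ f i
  ∑-idMat-* f i = begin
    ∑ (λ t → idMat i t * f t) ≡⟨ ∑-single i _ (λ t t≢i → cong (_* f t) (idMat-off i t (t≢i ∘ sym))) ⟩
    idMat i i * f i           ≡⟨ cong (_* f i) (idMat-diag i) ⟩
    + 1 * f i                 ≡⟨ ℤP.*-identityˡ (f i) ⟩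
    f i                       ∎
    where open ≡-Reasoning

  ∑-*-idMat : ∀ {k} (f : Fin k → ℤ) (i : Fin k) → ∑ (λ t → f t * idMat t i) ≡ f i
  ∑-*-idMat f i = trans (∑-cong (λ t → trans (ℤP.*-comm (f t) _) (cong (_* f t) (idMat-sym t))))
                        (∑-idMat-* f i)
    where
    idMat-sym : ∀ t → idMat t i ≡ idMat i t
    idMat-sym t = cong (λ b → if b then + 1 else + 0) (==-sym t i)

  ^^-row-mulVec : ∀ {k} (M : Mat k) e (g : Fin k → ℤ) i → ∑ (λ t → (M ^^ e) i t * g t) ≡ mulVec^ M e g i
  ^^-row-mulVec M zero g i = ∑-idMat-* g i
  ^^-row-mulVec M (suc e) g i = begin
    ∑ (λ t → ∑ (λ s → M i s * (M ^^ e) s t) * g t)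
      ≡⟨ ∑-cong (λ t → sym (∑-*ʳ (g t) (λ s → M i s * (M ^^ e) s t))) ⟩
    ∑ (λ t → ∑ (λ s → M i s * (M ^^ e) s t * g t))
      ≡⟨ ∑-comm (λ t s → M i s * (M ^^ e) s t * g t) ⟩
    ∑ (λ s → ∑ (λ t → M i s * (M ^^ e) s t * g t))
      ≡⟨ ∑-cong (λ s → trans (∑-cong (λ t → ℤP.*-assoc (M i s) _ (g t))) (∑-*ˡ (M i s) (λ t → (M ^^ e) s t * g t))) ⟩
    ∑ (λ s → M i s * ∑ (λ t → (M ^^ e) s t * g t))
      ≡⟨ ∑-cong (λ s → cong (M i s *_) (^^-row-mulVec M e g s)) ⟩
    mulVec^ M (suc e) g i ∎
    where open ≡-Reasoning

  -- The last factor of (Mᵀ)^(m+1) is absorbed into the starting vector, row i of M.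
  trace-pow-powᵀ : ∀ {k} (M : Mat k) m →
    trace ((M ^^ suc m) ⊗ (transpose M ^^ suc m))
      ≡ ∑ (λ i → mulVec^ M (suc m) (mulVec^ (transpose M) m (M i)) i)
  trace-pow-powᵀ M m = ∑-cong (λ i → trans (^^-row-mulVec M (suc m) _ i) (mulVec^-cong M (suc m) (column i) i))
    where
    Mᵀ = transpose M
    column : ∀ i t → (Mᵀ ^^ suc m) t i ≡ mulVec^ Mᵀ m (M i) t
    column i t = begin
      (Mᵀ ^^ suc m) t i                            ≡⟨ sym (∑-*-idMat (λ s → (Mᵀ ^^ suc m) t s) i) ⟩
      ∑ (λ s → (Mᵀ ^^ suc m) t s * idMat s i)      ≡⟨ ^^-row-mulVec Mᵀ (suc m) (λ s → idMat s i) t ⟩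
      mulVec^ Mᵀ (suc m) (λ s → idMat s i) t       ≡⟨ mulVec^-suc Mᵀ m _ t ⟩
      mulVec^ Mᵀ m (mulVec Mᵀ (λ s → idMat s i)) t ≡⟨ mulVec^-cong Mᵀ m (λ q → ∑-*-idMat (λ s → M s q) i) t ⟩
      mulVec^ Mᵀ m (M i) t                         ∎
      where open ≡-Reasoning

  -- Expanding the trace into signed paths

  follows : ∀ {n} → Fin n × Fin n → Fin n × Fin n → Bool
  follows p q = (proj₂ p == proj₁ q) ∧ not (proj₂ q == proj₁ p)

  module _ {n} (G : Graph n) (w : Signing G) where

    nbEntry : Fin n × Fin n → Fin n × Fin n → ℤ
    nbEntry p q = if follows p q then signedAdj G w (proj₁ q) (proj₂ q) else + 0

    nbStep : (Fin n × Fin n → ℤ) → Fin n × Fin n → ℤ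
    nbStep g p = ∑ (λ b → 𝟙 (adj G (proj₂ p) b) * (nbEntry p (proj₂ p , b) * g (proj₂ p , b)))

    nbStepᵀ : (Fin n × Fin n → ℤ) → Fin n × Fin n → ℤ
    nbStepᵀ g p = ∑ (λ a → 𝟙 (adj G a (proj₁ p)) * (nbEntry (a , proj₁ p) p * g (a , proj₁ p)))

    nbStep^ : ℕ → (Fin n × Fin n → ℤ) → Fin n × Fin n → ℤ
    nbStep^ zero g = g
    nbStep^ (suc k) g = nbStep (nbStep^ k g)

    nbStepᵀ^ : ℕ → (Fin n × Fin n → ℤ) → Fin n × Fin n → ℤ
    nbStepᵀ^ zero g = g
    nbStepᵀ^ (suc k) g = nbStepᵀ (nbStepᵀ^ k g)

    nbEntry-offˡ : ∀ p a b → ¬ (a ≡ proj₂ p) → nbEntry p (a , b) ≡ + 0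
    nbEntry-offˡ p a b a≢ rewrite ==-≢ (proj₂ p) a (a≢ ∘ sym) = refl

    nbEntry-offʳ : ∀ p a b → ¬ (b ≡ proj₁ p) → nbEntry (a , b) p ≡ + 0
    nbEntry-offʳ p a b b≢ rewrite ==-≢ b (proj₁ p) b≢ = refl

    private
      B : Mat (numDirEdges G)
      B = nbMatrix G w
      arc : Fin (numDirEdges G) → Fin n × Fin n
      arc = dirEdge G

    mulVec-nbMatrix : ∀ (g : Fin n × Fin n → ℤ) i → mulVec B (g ∘ arc) i ≡ nbStep g (arc i)
    mulVec-nbMatrix g i = trans (∑-dirEdge G (λ q → nbEntry p q * g q)) (∑-single (proj₂ p) _ off)
      where
      p = arc i
      off : ∀ a → ¬ (a ≡ proj₂ p) → ∑ (λ b → 𝟙 (adj G a b) * (nbEntry p (a , b) * g (a , b))) ≡ + 0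
      off a a≢ = begin
        ∑ (λ b → 𝟙 (adj G a b) * (nbEntry p (a , b) * g (a , b)))
          ≡⟨ ∑-cong (λ b → cong (λ z → 𝟙 (adj G a b) * (z * g (a , b))) (nbEntry-offˡ p a b a≢)) ⟩
        ∑ (λ b → 𝟙 (adj G a b) * (+ 0 * g (a , b)))
          ≡⟨ ∑-cong (λ b → ℤP.*-zeroʳ (𝟙 (adj G a b))) ⟩
        ∑ {n} (λ _ → + 0)
          ≡⟨ ∑-zero {n} ⟩
        + 0 ∎
        where open ≡-Reasoning

    mulVec-nbMatrixᵀ : ∀ (g : Fin n × Fin n → ℤ) i → mulVec (transpose B) (g ∘ arc) i ≡ nbStepᵀ g (arc i)
    mulVec-nbMatrixᵀ g i = trans (∑-dirEdge G (λ q → nbEntry q p * g q)) (∑-cong (λ a → ∑-single (proj₁ p) _ (off a)))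
      where
      p = arc i
      off : ∀ a b → ¬ (b ≡ proj₁ p) → 𝟙 (adj G a b) * (nbEntry (a , b) p * g (a , b)) ≡ + 0
      off a b b≢ = trans (cong (λ z → 𝟙 (adj G a b) * (z * g (a , b))) (nbEntry-offʳ p a b b≢))
                         (ℤP.*-zeroʳ (𝟙 (adj G a b)))

    mulVec^-nbMatrix : ∀ k (g : Fin n × Fin n → ℤ) i → mulVec^ B k (g ∘ arc) i ≡ nbStep^ k g (arc i)
    mulVec^-nbMatrix zero g i = refl
    mulVec^-nbMatrix (suc k) g i =
      trans (mulVec-cong B (mulVec^-nbMatrix k g) i) (mulVec-nbMatrix (nbStep^ k g) i)

    mulVec^-nbMatrixᵀ : ∀ k (g : Fin n × Fin n → ℤ) i → mulVec^ (transpose B) k (g ∘ arc) i ≡ nbStepᵀ^ k g (arc i)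
    mulVec^-nbMatrixᵀ zero g i = refl
    mulVec^-nbMatrixᵀ (suc k) g i =
      trans (mulVec-cong (transpose B) (mulVec^-nbMatrixᵀ k g) i) (mulVec-nbMatrixᵀ (nbStepᵀ^ k g) i)

    edgeTerm : ℕ → Fin n × Fin n → ℤ
    edgeTerm m p = nbStep^ (suc m) (nbStepᵀ^ m (nbEntry p)) p

    Tval≡∑edgeTerm : ∀ m → Tval G (suc m) w ≡ ∑ (λ a → ∑ (λ b → 𝟙 (adj G a b) * edgeTerm m (a , b)))
    Tval≡∑edgeTerm m = begin
      Tval G (suc m) w
        ≡⟨ trace-pow-powᵀ B m ⟩
      ∑ (λ i → mulVec^ B (suc m) (mulVec^ (transpose B) m (B i)) i)
        ≡⟨ ∑-cong (λ i → mulVec^-cong B (suc m) (mulVec^-nbMatrixᵀ m (nbEntry (arc i))) i) ⟩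
      ∑ (λ i → mulVec^ B (suc m) (nbStepᵀ^ m (nbEntry (arc i)) ∘ arc) i)
        ≡⟨ ∑-cong (λ i → mulVec^-nbMatrix (suc m) (nbStepᵀ^ m (nbEntry (arc i))) i) ⟩
      ∑ (λ i → edgeTerm m (arc i))
        ≡⟨ ∑-dirEdge G (edgeTerm m) ⟩
      ∑ (λ a → ∑ (λ b → 𝟙 (adj G a b) * edgeTerm m (a , b))) ∎
      where open ≡-Reasoning

  module _ {n : ℕ} where

    ∑Seq : (k : ℕ) → (Vec (Fin n) k → ℤ) → ℤ
    ∑Seq zero f = f []
    ∑Seq (suc k) f = ∑ (λ x → ∑Seq k (λ v → f (x ∷ v)))

    ∑Seq-cong : ∀ k {f g : Vec (Fin n) k → ℤ} → (∀ v → f v ≡ g v) → ∑Seq k f ≡ ∑Seq k g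
    ∑Seq-cong zero eq = eq []
    ∑Seq-cong (suc k) eq = ∑-cong (λ x → ∑Seq-cong k (λ v → eq (x ∷ v)))

    ∑Seq-*ˡ : ∀ k (c : ℤ) (f : Vec (Fin n) k → ℤ) → ∑Seq k (λ v → c * f v) ≡ c * ∑Seq k f
    ∑Seq-*ˡ zero c f = refl
    ∑Seq-*ˡ (suc k) c f = trans (∑-cong (λ x → ∑Seq-*ˡ k c (λ v → f (x ∷ v))))
                                (∑-*ˡ c (λ x → ∑Seq k (λ v → f (x ∷ v))))

    ∑Seq-mono-≤ : ∀ k {f g : Vec (Fin n) k → ℤ} → (∀ v → f v ≤ g v) → ∑Seq k f ≤ ∑Seq k g
    ∑Seq-mono-≤ zero h = h []
    ∑Seq-mono-≤ (suc k) h = ∑-mono-≤ (λ x → ∑Seq-mono-≤ k (λ v → h (x ∷ v)))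

    ∑Seq-∷ʳ : ∀ k (f : Vec (Fin n) (suc k) → ℤ) → ∑Seq (suc k) f ≡ ∑Seq k (λ u → ∑ (λ z → f (u V.∷ʳ z)))
    ∑Seq-∷ʳ zero f = refl
    ∑Seq-∷ʳ (suc k) f = ∑-cong (λ x → ∑Seq-∷ʳ k (λ v → f (x ∷ v)))

    ∑Seq-++ : ∀ a b (f : Vec (Fin n) (a ℕ.+ b) → ℤ) → ∑Seq (a ℕ.+ b) f ≡ ∑Seq a (λ u → ∑Seq b (λ v → f (u V.++ v)))
    ∑Seq-++ zero b f = refl
    ∑Seq-++ (suc a) b f = ∑-cong (λ x → ∑Seq-++ a b (λ v → f (x ∷ v)))

    ∑Seq-pull₂ : ∀ k a b (f g : Vec (Fin n) k → ℤ) →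
      a * (b * ∑Seq k (λ v → f v * g v)) ≡ ∑Seq k (λ v → (a * (b * f v)) * g v)
    ∑Seq-pull₂ k a b f g = begin
      a * (b * ∑Seq k (λ v → f v * g v))     ≡⟨ cong (a *_) (sym (∑Seq-*ˡ k b _)) ⟩
      a * ∑Seq k (λ v → b * (f v * g v))     ≡⟨ sym (∑Seq-*ˡ k a _) ⟩
      ∑Seq k (λ v → a * (b * (f v * g v)))   ≡⟨ ∑Seq-cong k (λ v → reassoc (f v) (g v)) ⟩
      ∑Seq k (λ v → (a * (b * f v)) * g v)   ∎
      where
      open ≡-Reasoning
      reassoc : ∀ x y → a * (b * (x * y)) ≡ (a * (b * x)) * y
      reassoc x y = trans (cong (a *_) (sym (ℤP.*-assoc b x y))) (sym (ℤP.*-assoc a (b * x) y))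

    endFwd : ∀ {k} → Fin n × Fin n → Vec (Fin n) k → Fin n × Fin n
    endFwd p [] = p
    endFwd p (b ∷ bs) = endFwd (proj₂ p , b) bs

    endBwd : ∀ {k} → Fin n × Fin n → Vec (Fin n) k → Fin n × Fin n
    endBwd p [] = p
    endBwd p (a ∷ as) = endBwd (a , proj₁ p) as

  module _ {n} (G : Graph n) (w : Signing G) where

    weightFwd : ∀ {k} → Fin n × Fin n → Vec (Fin n) k → ℤ
    weightFwd p [] = + 1
    weightFwd p (b ∷ bs) = 𝟙 (adj G (proj₂ p) b) * (nbEntry G w p (proj₂ p , b) * weightFwd (proj₂ p , b) bs)

    weightBwd : ∀ {k} → Fin n × Fin n → Vec (Fin n) k → ℤ
    weightBwd p [] = + 1
    weightBwd p (a ∷ as) = 𝟙 (adj G a (proj₁ p)) * (nbEntry G w (a , proj₁ p) p * weightBwd (a , proj₁ p) as)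

    nbStep^≡∑Seq : ∀ k g p → nbStep^ G w k g p ≡ ∑Seq k (λ bs → weightFwd p bs * g (endFwd p bs))
    nbStep^≡∑Seq zero g p = sym (ℤP.*-identityˡ _)
    nbStep^≡∑Seq (suc k) g p = ∑-cong λ b →
      let q = (proj₂ p , b) in
      trans (cong (λ z → 𝟙 (adj G (proj₂ p) b) * (nbEntry G w p q * z)) (nbStep^≡∑Seq k g q))
            (∑Seq-pull₂ k (𝟙 (adj G (proj₂ p) b)) (nbEntry G w p q) (weightFwd q) (g ∘ endFwd q))

    nbStepᵀ^≡∑Seq : ∀ k g p → nbStepᵀ^ G w k g p ≡ ∑Seq k (λ as → weightBwd p as * g (endBwd p as))
    nbStepᵀ^≡∑Seq zero g p = sym (ℤP.*-identityˡ _)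
    nbStepᵀ^≡∑Seq (suc k) g p = ∑-cong λ a →
      let q = (a , proj₁ p) in
      trans (cong (λ z → 𝟙 (adj G a (proj₁ p)) * (nbEntry G w q p * z)) (nbStepᵀ^≡∑Seq k g q))
            (∑Seq-pull₂ k (𝟙 (adj G a (proj₁ p))) (nbEntry G w q p) (weightBwd q) (g ∘ endBwd q))

    -- bs walks forward m+1 steps from p, as walks backward m steps from there,
    -- and the final nbEntry closes the path up into p.
    pathWeight : ∀ {m} → Fin n × Fin n → Vec (Fin n) (suc m) → Vec (Fin n) m → ℤ
    pathWeight p bs as = weightFwd p bs * (weightBwd (endFwd p bs) as * nbEntry G w p (endBwd (endFwd p bs) as))

    edgeTerm≡∑Seq : ∀ m p → edgeTerm G w m p ≡ ∑Seq (suc m) (λ bs → ∑Seq m (pathWeight p bs))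
    edgeTerm≡∑Seq m p = trans (nbStep^≡∑Seq (suc m) _ p) (∑Seq-cong (suc m) inner)
      where
      inner : ∀ bs → weightFwd p bs * nbStepᵀ^ G w m (nbEntry G w p) (endFwd p bs)
                   ≡ ∑Seq m (pathWeight p bs)
      inner bs = trans (cong (weightFwd p bs *_) (nbStepᵀ^≡∑Seq m (nbEntry G w p) (endFwd p bs)))
                       (sym (∑Seq-*ˡ m (weightFwd p bs) _))

  𝟙-merge : ∀ a x c y → (𝟙 a * x) * (𝟙 c * y) ≡ 𝟙 (a ∧ c) * (x * y)
  𝟙-merge a x c y = trans (*-interchange (𝟙 a) x (𝟙 c) y) (cong (_* (x * y)) (sym (𝟙-∧ a c)))

  𝟙-pull : ∀ a c x v y → 𝟙 a * ((𝟙 c * x) * (𝟙 v * y)) ≡ 𝟙 (a ∧ (c ∧ v)) * (x * y)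
  𝟙-pull a c x v y = begin
    𝟙 a * ((𝟙 c * x) * (𝟙 v * y)) ≡⟨ cong (𝟙 a *_) (𝟙-merge c x v y) ⟩
    𝟙 a * (𝟙 (c ∧ v) * (x * y))   ≡⟨ sym (ℤP.*-assoc (𝟙 a) _ _) ⟩
    (𝟙 a * 𝟙 (c ∧ v)) * (x * y)   ≡⟨ cong (_* (x * y)) (sym (𝟙-∧ a (c ∧ v))) ⟩
    𝟙 (a ∧ (c ∧ v)) * (x * y)     ∎
    where open ≡-Reasoning

  module _ {n : ℕ} where

    stepsFwd : ∀ {k} → Fin n × Fin n → Vec (Fin n) k → List (Fin n × Fin n)
    stepsFwd p [] = []
    stepsFwd p (b ∷ bs) = (proj₂ p , b) ∷ stepsFwd (proj₂ p , b) bs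

    stepsBwd : ∀ {k} → Fin n × Fin n → Vec (Fin n) k → List (Fin n × Fin n)
    stepsBwd p [] = []
    stepsBwd p (a ∷ as) = p ∷ stepsBwd (a , proj₁ p) as

    length-stepsFwd : ∀ {k} p (bs : Vec (Fin n) k) → L.length (stepsFwd p bs) ≡ k
    length-stepsFwd p [] = refl
    length-stepsFwd p (b ∷ bs) = cong suc (length-stepsFwd (proj₂ p , b) bs)

    length-stepsBwd : ∀ {k} p (as : Vec (Fin n) k) → L.length (stepsBwd p as) ≡ k
    length-stepsBwd p [] = refl
    length-stepsBwd p (a ∷ as) = cong suc (length-stepsBwd (a , proj₁ p) as)

    pathSteps : ∀ {m} → Fin n × Fin n → Vec (Fin n) (suc m) → Vec (Fin n) m → List (Fin n × Fin n)
    pathSteps p bs as = stepsFwd p bs ++ (stepsBwd (endFwd p bs) as ++ (endBwd (endFwd p bs) as ∷ []))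

  module _ {n} (G : Graph n) where

    signOf : Signing G → Fin n × Fin n → ℤ
    signOf w q = signedAdj G w (proj₁ q) (proj₂ q)

    signProduct : Signing G → List (Fin n × Fin n) → ℤ
    signProduct w [] = + 1
    signProduct w (s ∷ ss) = signOf w s * signProduct w ss

    signProduct-++ : ∀ w xs ys → signProduct w (xs ++ ys) ≡ signProduct w xs * signProduct w ys
    signProduct-++ w [] ys = sym (ℤP.*-identityˡ _)
    signProduct-++ w (x ∷ xs) ys =
      trans (cong (signOf w x *_) (signProduct-++ w xs ys)) (sym (ℤP.*-assoc (signOf w x) _ _))

    nbEntry≡ : ∀ w p q → nbEntry G w p q ≡ 𝟙 (follows p q) * signOf w q
    nbEntry≡ w p q with follows p q
    ... | true = sym (ℤP.*-identityˡ _)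
    ... | false = refl

    validFwd : ∀ {k} → Fin n × Fin n → Vec (Fin n) k → Bool
    validFwd p [] = true
    validFwd p (b ∷ bs) = adj G (proj₂ p) b ∧ (follows p (proj₂ p , b) ∧ validFwd (proj₂ p , b) bs)

    validBwd : ∀ {k} → Fin n × Fin n → Vec (Fin n) k → Bool
    validBwd p [] = true
    validBwd p (a ∷ as) = adj G a (proj₁ p) ∧ (follows (a , proj₁ p) p ∧ validBwd (a , proj₁ p) as)

    weightFwd≡ : ∀ w {k} p (bs : Vec (Fin n) k) →
      weightFwd G w p bs ≡ 𝟙 (validFwd p bs) * signProduct w (stepsFwd p bs)
    weightFwd≡ w p [] = refl
    weightFwd≡ w p (b ∷ bs) =
      let q = (proj₂ p , b) in
      trans (cong₂ (λ x y → 𝟙 (adj G (proj₂ p) b) * (x * y)) (nbEntry≡ w p q) (weightFwd≡ w q bs))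
            (𝟙-pull (adj G (proj₂ p) b) (follows p q) (signOf w q) (validFwd q bs) _)

    weightBwd≡ : ∀ w {k} p (as : Vec (Fin n) k) →
      weightBwd G w p as ≡ 𝟙 (validBwd p as) * signProduct w (stepsBwd p as)
    weightBwd≡ w p [] = refl
    weightBwd≡ w p (a ∷ as) =
      let q = (a , proj₁ p) in
      trans (cong₂ (λ x y → 𝟙 (adj G a (proj₁ p)) * (x * y)) (nbEntry≡ w q p) (weightBwd≡ w q as))
            (𝟙-pull (adj G a (proj₁ p)) (follows q p) (signOf w p) (validBwd q as) _)

    validPath : ∀ {m} → Fin n × Fin n → Vec (Fin n) (suc m) → Vec (Fin n) m → Bool
    validPath p bs as = validFwd p bs ∧ (validBwd (endFwd p bs) as ∧ follows p (endBwd (endFwd p bs) as))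

    pathWeight≡ : ∀ w {m} p (bs : Vec (Fin n) (suc m)) (as : Vec (Fin n) m) →
      pathWeight G w p bs as ≡ 𝟙 (validPath p bs as) * signProduct w (pathSteps p bs as)
    pathWeight≡ w p bs as = begin
      weightFwd G w p bs * (weightBwd G w q as * nbEntry G w p r)
        ≡⟨ cong₂ _*_ (weightFwd≡ w p bs) (cong₂ _*_ (weightBwd≡ w q as) (nbEntry≡ w p r)) ⟩
      (𝟙 (validFwd p bs) * Pf) * ((𝟙 (validBwd q as) * Pb) * (𝟙 (follows p r) * signOf w r))
        ≡⟨ cong ((𝟙 (validFwd p bs) * Pf) *_) (𝟙-merge (validBwd q as) Pb (follows p r) _) ⟩
      (𝟙 (validFwd p bs) * Pf) * (𝟙 (validBwd q as ∧ follows p r) * (Pb * signOf w r))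
        ≡⟨ 𝟙-merge (validFwd p bs) Pf (validBwd q as ∧ follows p r) _ ⟩
      𝟙 (validPath p bs as) * (Pf * (Pb * signOf w r))
        ≡⟨ cong (λ z → 𝟙 (validPath p bs as) * (Pf * z)) (sym close-up) ⟩
      𝟙 (validPath p bs as) * (Pf * signProduct w (stepsBwd q as ++ (r ∷ [])))
        ≡⟨ cong (𝟙 (validPath p bs as) *_) (sym (signProduct-++ w (stepsFwd p bs) _)) ⟩
      𝟙 (validPath p bs as) * signProduct w (pathSteps p bs as) ∎
      where
      open ≡-Reasoning
      q = endFwd p bs
      r = endBwd q as
      Pf = signProduct w (stepsFwd p bs)
      Pb = signProduct w (stepsBwd q as)
      close-up : signProduct w (stepsBwd q as ++ (r ∷ [])) ≡ Pb * signOf w r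
      close-up = trans (signProduct-++ w (stepsBwd q as) (r ∷ [])) (cong (Pb *_) (ℤP.*-identityʳ _))

  -- Edge indices and crossing parities

  lookup-filterᵇ : ∀ {A : Set} (p : A → Bool) (xs : List A) (i : Fin (L.length (L.filterᵇ p xs))) →
    p (L.lookup (L.filterᵇ p xs) i) ≡ true
  lookup-filterᵇ p (x ∷ xs) i with p x in eq
  lookup-filterᵇ p (x ∷ xs) F.zero    | true = eq
  lookup-filterᵇ p (x ∷ xs) (F.suc i) | true = lookup-filterᵇ p xs i
  ... | false = lookup-filterᵇ p xs i

  <ᵇ-true : ∀ {a b} → a ℕ.< b → (a <ᵇ b) ≡ true
  <ᵇ-true h = Equivalence.to BP.T-≡ (ℕP.<⇒<ᵇ h)

  <ᵇ-false : ∀ {a b} → ¬ (a ℕ.< b) → (a <ᵇ b) ≡ false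
  <ᵇ-false {a} {b} a≮b with a <ᵇ b in eq
  ... | false = refl
  ... | true = ⊥-elim (a≮b (ℕP.<ᵇ⇒< a b (Equivalence.from BP.T-≡ eq)))

  <ᵇ-true⁻ : ∀ {a b} → (a <ᵇ b) ≡ true → a ℕ.< b
  <ᵇ-true⁻ {a} {b} eq = ℕP.<ᵇ⇒< a b (Equivalence.from BP.T-≡ eq)

  module _ {n : ℕ} where

    pairEq : Fin n × Fin n → Fin n × Fin n → Bool
    pairEq x y = (proj₁ x == proj₁ y) ∧ (proj₂ x == proj₂ y)

    pairEq⇒≡ : ∀ x y → pairEq x y ≡ true → x ≡ y
    pairEq⇒≡ x y h with ∧-true⁻ {proj₁ x == proj₁ y} h
    ... | h₁ , h₂ = cong₂ _,_ (==⇒≡ _ _ h₁) (==⇒≡ _ _ h₂)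

    pairEq-refl : ∀ x → pairEq x x ≡ true
    pairEq-refl x rewrite ==-refl (proj₁ x) | ==-refl (proj₂ x) = refl

    pairEq-≢ : ∀ x y → ¬ (x ≡ y) → pairEq x y ≡ false
    pairEq-≢ x y x≢y with pairEq x y in eq
    ... | true = ⊥-elim (x≢y (pairEq⇒≡ x y eq))
    ... | false = refl

    pairEq-comm : ∀ x y → pairEq x y ≡ pairEq y x
    pairEq-comm x y = cong₂ _∧_ (==-sym (proj₁ x) (proj₁ y)) (==-sym (proj₂ x) (proj₂ y))

    -- edgeList lists each edge {a,b} once, as sortPair (a , b).
    sortPair : Fin n × Fin n → Fin n × Fin n
    sortPair s = if toℕ (proj₁ s) <ᵇ toℕ (proj₂ s) then s else swap s

    sortPair-< : ∀ s → toℕ (proj₁ s) ℕ.< toℕ (proj₂ s) → sortPair s ≡ s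
    sortPair-< s h rewrite <ᵇ-true h = refl

    sortPair-> : ∀ s → toℕ (proj₂ s) ℕ.< toℕ (proj₁ s) → sortPair s ≡ swap s
    sortPair-> s h rewrite <ᵇ-false (ℕP.<⇒≯ h) = refl

    sortPair-cases : ∀ s → (sortPair s ≡ s) ⊎ (sortPair s ≡ swap s)
    sortPair-cases s with toℕ (proj₁ s) <ᵇ toℕ (proj₂ s)
    ... | true = inj₁ refl
    ... | false = inj₂ refl

    sortPair-swap : ∀ s → sortPair (swap s) ≡ sortPair s
    sortPair-swap (a , b) with ℕP.<-cmp (toℕ a) (toℕ b)
    ... | tri< lt _ _ = trans (sortPair-> (b , a) lt) (sym (sortPair-< (a , b) lt))
    ... | tri> _ _ gt = trans (sortPair-< (b , a) gt) (sym (sortPair-> (a , b) gt))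
    ... | tri≈ _ eq _ rewrite FP.toℕ-injective eq = refl

    sortPair-injective : ∀ s t → sortPair s ≡ sortPair t → (s ≡ t) ⊎ (s ≡ swap t)
    sortPair-injective s t eq with sortPair-cases s | sortPair-cases t
    ... | inj₁ e₁ | inj₁ e₂ = inj₁ (trans (sym e₁) (trans eq e₂))
    ... | inj₁ e₁ | inj₂ e₂ = inj₂ (trans (sym e₁) (trans eq e₂))
    ... | inj₂ e₁ | inj₁ e₂ = inj₂ (cong swap (trans (sym e₁) (trans eq e₂)))
    ... | inj₂ e₁ | inj₂ e₂ = inj₁ (cong swap (trans (sym e₁) (trans eq e₂)))

  module EdgeIndexing {n} (G : Graph n) where

    isEdgeKey : Fin n × Fin n → Bool
    isEdgeKey p = (toℕ (proj₁ p) <ᵇ toℕ (proj₂ p)) ∧ adj G (proj₁ p) (proj₂ p)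

    edge-isEdgeKey : ∀ e → isEdgeKey (edge G e) ≡ true
    edge-isEdgeKey e = lookup-filterᵇ isEdgeKey (allPairs n) e

    adj⇒≢ : ∀ a b → adj G a b ≡ true → ¬ (a ≡ b)
    adj⇒≢ a .a h refl with trans (sym h) (irrefl G a)
    ... | ()

    isEdgeKey-sortPair : ∀ s → adj G (proj₁ s) (proj₂ s) ≡ true → isEdgeKey (sortPair s) ≡ true
    isEdgeKey-sortPair s h with ℕP.<-cmp (toℕ (proj₁ s)) (toℕ (proj₂ s))
    ... | tri< lt _ _ rewrite sortPair-< s lt | <ᵇ-true lt = h
    ... | tri> _ _ gt rewrite sortPair-> s gt | <ᵇ-true gt = trans (Graph.sym G (proj₂ s) (proj₁ s)) h
    ... | tri≈ _ eq _ = ⊥-elim (adj⇒≢ _ _ h (FP.toℕ-injective eq))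

    ∑-edge-key : ∀ q → isEdgeKey q ≡ true → ∑ (λ e → 𝟙 (pairEq (edge G e) q)) ≡ + 1
    ∑-edge-key q key = begin
      ∑ (λ e → 𝟙 (pairEq (edge G e) q))
        ≡⟨ sumList-lookup (edgeList G) (λ x → 𝟙 (pairEq x q)) ⟩
      sumList (L.map (λ x → 𝟙 (pairEq x q)) (edgeList G))
        ≡⟨ sumList-filter isEdgeKey (λ x → 𝟙 (pairEq x q)) (allPairs n) ⟩
      sumList (L.map (λ x → 𝟙 (isEdgeKey x) * 𝟙 (pairEq x q)) (allPairs n))
        ≡⟨ sumList-allPairs (λ x → 𝟙 (isEdgeKey x) * 𝟙 (pairEq x q)) ⟩
      ∑ (λ a → ∑ (λ b → 𝟙 (isEdgeKey (a , b)) * 𝟙 (pairEq (a , b) q)))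
        ≡⟨ ∑-single (proj₁ q) _ (λ a a≢ → trans (∑-cong (λ b → vanish (a , b) (a≢ ∘ cong proj₁))) (∑-zero {n})) ⟩
      ∑ (λ b → 𝟙 (isEdgeKey (proj₁ q , b)) * 𝟙 (pairEq (proj₁ q , b) q))
        ≡⟨ ∑-single (proj₂ q) _ (λ b b≢ → vanish (proj₁ q , b) (b≢ ∘ cong proj₂)) ⟩
      𝟙 (isEdgeKey q) * 𝟙 (pairEq q q)
        ≡⟨ cong₂ (λ x y → 𝟙 x * 𝟙 y) key (pairEq-refl q) ⟩
      + 1 ∎
      where
      open ≡-Reasoning
      vanish : ∀ x → ¬ (x ≡ q) → 𝟙 (isEdgeKey x) * 𝟙 (pairEq x q) ≡ + 0
      vanish x x≢q rewrite pairEq-≢ x q x≢q = ℤP.*-zeroʳ (𝟙 (isEdgeKey x))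

    record EdgeIndex (s : Fin n × Fin n) : Set where
      field
        index : Fin (numEdges G)
        index-edge : edge G index ≡ sortPair s
        index-unique : ∀ e → edge G e ≡ sortPair s → e ≡ index

    edgeIndex : ∀ s → adj G (proj₁ s) (proj₂ s) ≡ true → EdgeIndex s
    edgeIndex s h with ∑𝟙≡1⇒unique (λ e → pairEq (edge G e) (sortPair s)) (∑-edge-key (sortPair s) (isEdgeKey-sortPair s h))
    ... | e , pe , u = record
      { index = e
      ; index-edge = pairEq⇒≡ (edge G e) (sortPair s) pe
      ; index-unique = λ e′ eq → u e′ (subst (λ z → pairEq z (sortPair s) ≡ true) (sym eq) (pairEq-refl (sortPair s)))
      }

    matches : Fin (numEdges G) → Fin n × Fin n → Bool
    matches e s = pairEq (edge G e) s ∨ pairEq (edge G e) (swap s)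

    matches⇒edge≡ : ∀ e s → matches e s ≡ true → edge G e ≡ sortPair s
    matches⇒edge≡ e s h with <ᵇ-true⁻ (proj₁ (∧-true⁻ (edge-isEdgeKey e))) | ∨-true⁻ {pairEq (edge G e) s} h
    ... | ordered | inj₁ p =
      let eq = pairEq⇒≡ (edge G e) s p in
      trans eq (sym (sortPair-< s (subst (λ x → toℕ (proj₁ x) ℕ.< toℕ (proj₂ x)) eq ordered)))
    ... | ordered | inj₂ p =
      let eq = pairEq⇒≡ (edge G e) (swap s) p in
      trans eq (sym (sortPair-> s (subst (λ x → toℕ (proj₁ x) ℕ.< toℕ (proj₂ x)) eq ordered)))

    edge≡⇒matches : ∀ e s → edge G e ≡ sortPair s → matches e s ≡ true
    edge≡⇒matches e s eq with sortPair-cases s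
    ... | inj₁ e₁ rewrite trans eq e₁ | pairEq-refl s = refl
    ... | inj₂ e₂ rewrite trans eq e₂ | pairEq-refl (swap s) = BP.∨-zeroʳ _

    signedAdj≡wt : ∀ w s (h : adj G (proj₁ s) (proj₂ s) ≡ true) →
      signedAdj G w (proj₁ s) (proj₂ s) ≡ wt G w (EdgeIndex.index (edgeIndex s h))
    signedAdj≡wt w s h = trans (∑-single e₀ _ off) on
      where
      I = edgeIndex s h
      e₀ = EdgeIndex.index I
      off : ∀ e → ¬ (e ≡ e₀) → (if matches e s then wt G w e else + 0) ≡ + 0
      off e e≢e₀ with matches e s in eq
      ... | false = refl
      ... | true = ⊥-elim (e≢e₀ (EdgeIndex.index-unique I e (matches⇒edge≡ e s eq)))
      on : (if matches e₀ s then wt G w e₀ else + 0) ≡ wt G w e₀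
      on rewrite edge≡⇒matches e₀ s (EdgeIndex.index-edge I) = refl

  isEvenℕ-suc : ∀ k → isEvenℕ (suc k) ≡ not (isEvenℕ k)
  isEvenℕ-suc zero = refl
  isEvenℕ-suc (suc k) = trans (sym (BP.not-involutive (isEvenℕ k))) (cong not (sym (isEvenℕ-suc k)))

  isEvenℕ-+-double : ∀ t x → isEvenℕ ((t ℕ.+ t) ℕ.+ x) ≡ isEvenℕ x
  isEvenℕ-+-double zero x = refl
  isEvenℕ-+-double (suc t) x rewrite ℕP.+-suc t t = isEvenℕ-+-double t x

  𝟙-odd≤ : ∀ c → 𝟙 (not (isEvenℕ c)) ≤ + c
  𝟙-odd≤ zero = ℤP.≤-refl
  𝟙-odd≤ (suc c) = ℤP.≤-trans (𝟙≤1 (not (isEvenℕ (suc c)))) (ℤ.+≤+ (ℕ.s≤s ℕ.z≤n))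

  sgn-square : ∀ b → sgn b * sgn b ≡ + 1
  sgn-square true = refl
  sgn-square false = refl

  ∣S∣≡∑ : ∀ {k} (S : Subset k) → + ∣ S ∣ ≡ ∑ (λ e → 𝟙 (V.lookup S e))
  ∣S∣≡∑ [] = refl
  ∣S∣≡∑ (true ∷ S) = cong (_+_ (+ 1)) (∣S∣≡∑ S)
  ∣S∣≡∑ (false ∷ S) = trans (∣S∣≡∑ S) (sym (ℤP.+-identityˡ _))

  ∣S∣≡0⇒empty : ∀ {k} (S : Subset k) → ∣ S ∣ ≡ 0 → ∀ e → V.lookup S e ≡ false
  ∣S∣≡0⇒empty (false ∷ S) h F.zero = refl
  ∣S∣≡0⇒empty (false ∷ S) h (F.suc e) = ∣S∣≡0⇒empty S h e

  prodOver-empty : ∀ {n} (G : Graph n) (S : Subset (numEdges G)) w → ∣ S ∣ ≡ 0 → prodOver G S w ≡ + 1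
  prodOver-empty G S w h = ∏-ones _ (λ e → cong (λ b → if b then wt G w e else + 1) (∣S∣≡0⇒empty S h e))

  module Parity {n} (G : Graph n) where
    open EdgeIndexing G

    allAdjacent : List (Fin n × Fin n) → Bool
    allAdjacent = allᵇ (λ s → adj G (proj₁ s) (proj₂ s))

    crossings : Fin n × Fin n → List (Fin n × Fin n) → ℕ
    crossings k [] = 0
    crossings k (s ∷ L) = if pairEq (sortPair s) k then suc (crossings k L) else crossings k L

    oddEdges : List (Fin n × Fin n) → Subset (numEdges G)
    oddEdges L = V.tabulate (λ e → not (isEvenℕ (crossings (edge G e) L)))

    lookup-oddEdges : ∀ L e → V.lookup (oddEdges L) e ≡ not (isEvenℕ (crossings (edge G e) L))
    lookup-oddEdges L e = VP.lookup∘tabulate _ e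

    signProduct≡prodOver : ∀ w L → allAdjacent L ≡ true → signProduct G w L ≡ prodOver G (oddEdges L) w
    signProduct≡prodOver w [] h =
      sym (∏-ones _ (λ e → cong (λ b → if b then wt G w e else + 1) (lookup-oddEdges [] e)))
    signProduct≡prodOver w (s ∷ L) h with ∧-true⁻ {adj G (proj₁ s) (proj₂ s)} h
    ... | adj-s , adj-L = begin
      signOf G w s * signProduct G w L      ≡⟨ cong₂ _*_ (signedAdj≡wt w s adj-s) (signProduct≡prodOver w L adj-L) ⟩
      wt G w e₀ * prodOver G (oddEdges L) w ≡⟨ sym (∏-scale-at (factor L) (factor (s ∷ L)) e₀ (wt G w e₀) at-e₀ off-e₀) ⟩
      prodOver G (oddEdges (s ∷ L)) w       ∎
      where
      open ≡-Reasoning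
      I = edgeIndex s adj-s
      e₀ = EdgeIndex.index I
      factor : List (Fin n × Fin n) → Fin (numEdges G) → ℤ
      factor L′ e = if V.lookup (oddEdges L′) e then wt G w e else + 1
      s-crosses-e₀ : pairEq (sortPair s) (edge G e₀) ≡ true
      s-crosses-e₀ = trans (pairEq-comm (sortPair s) (edge G e₀))
        (subst (λ z → pairEq (edge G e₀) z ≡ true) (EdgeIndex.index-edge I) (pairEq-refl (edge G e₀)))
      -- one more crossing flips the parity of e₀, and wt e₀ * wt e₀ = 1
      at-e₀ : factor (s ∷ L) e₀ ≡ wt G w e₀ * factor L e₀
      at-e₀ rewrite lookup-oddEdges (s ∷ L) e₀ | lookup-oddEdges L e₀ | s-crosses-e₀
                  | isEvenℕ-suc (crossings (edge G e₀) L) with isEvenℕ (crossings (edge G e₀) L)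
      ... | false = sym (sgn-square (V.lookup w e₀))
      ... | true = sym (ℤP.*-identityʳ _)
      off-e₀ : ∀ e → ¬ (e ≡ e₀) → factor (s ∷ L) e ≡ factor L e
      off-e₀ e e≢e₀ rewrite lookup-oddEdges (s ∷ L) e | lookup-oddEdges L e
        with pairEq (sortPair s) (edge G e) in eq
      ... | false = refl
      ... | true = ⊥-elim (e≢e₀ (EdgeIndex.index-unique I e (sym (pairEq⇒≡ _ _ eq))))

    ∑-crossings : ∀ L → allAdjacent L ≡ true → ∑ (λ e → + crossings (edge G e) L) ≡ + L.length L
    ∑-crossings [] h = ∑-zero {numEdges G}
    ∑-crossings (s ∷ L) h with ∧-true⁻ {adj G (proj₁ s) (proj₂ s)} h
    ... | adj-s , adj-L = begin
      ∑ (λ e → + crossings (edge G e) (s ∷ L))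
        ≡⟨ ∑-cong (λ e → +-if (pairEq (sortPair s) (edge G e)) (crossings (edge G e) L)) ⟩
      ∑ (λ e → 𝟙 (pairEq (sortPair s) (edge G e)) + + crossings (edge G e) L)
        ≡⟨ ∑-distrib-+ (λ e → 𝟙 (pairEq (sortPair s) (edge G e))) _ ⟩
      ∑ (λ e → 𝟙 (pairEq (sortPair s) (edge G e))) + ∑ (λ e → + crossings (edge G e) L)
        ≡⟨ cong₂ _+_ (trans (∑-cong (λ e → cong 𝟙 (pairEq-comm (sortPair s) (edge G e))))
                            (∑-edge-key (sortPair s) (isEdgeKey-sortPair s adj-s)))
                     (∑-crossings L adj-L) ⟩
      + L.length (s ∷ L) ∎
      where
      open ≡-Reasoning
      +-if : ∀ b c → + (if b then suc c else c) ≡ 𝟙 b + + c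
      +-if true c = refl
      +-if false c = sym (ℤP.+-identityˡ _)

    ∣oddEdges∣≤length : ∀ L → allAdjacent L ≡ true → ∣ oddEdges L ∣ ℕ.≤ L.length L
    ∣oddEdges∣≤length L h = ℤP.drop‿+≤+ (begin
      + ∣ oddEdges L ∣                                   ≡⟨ ∣S∣≡∑ (oddEdges L) ⟩
      ∑ (λ e → 𝟙 (V.lookup (oddEdges L) e))              ≡⟨ ∑-cong (λ e → cong 𝟙 (lookup-oddEdges L e)) ⟩
      ∑ (λ e → 𝟙 (not (isEvenℕ (crossings (edge G e) L)))) ≤⟨ ∑-mono-≤ (λ e → 𝟙-odd≤ (crossings (edge G e) L)) ⟩
      ∑ (λ e → + crossings (edge G e) L)                 ≡⟨ ∑-crossings L h ⟩
      + L.length L                                       ∎)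
      where open ℤP.≤-Reasoning

    oddEdges-empty : ∀ L → ∣ oddEdges L ∣ ≡ 0 → ∀ e → isEvenℕ (crossings (edge G e) L) ≡ true
    oddEdges-empty L h e = trans (sym (BP.not-involutive _))
      (cong not (trans (sym (lookup-oddEdges L e)) (∣S∣≡0⇒empty (oddEdges L) h e)))

  -- Weighted sums

  toℚᵘ-toℚ : ∀ z → ℚ.toℚᵘ (toℚ z) ≡ ℚᵘ.mkℚᵘ z 0
  toℚᵘ-toℚ (+ k) rewrite ℚP.normalize-coprime {k} {0} (Cop.sym (Cop.1-coprimeTo k)) = refl
  toℚᵘ-toℚ -[1+ k ] rewrite ℚP.normalize-coprime {suc k} {0} (Cop.sym (Cop.1-coprimeTo (suc k))) = refl

  toℚ-+ : ∀ a b → toℚ (a + b) ≡ toℚ a ℚ.+ toℚ b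
  toℚ-+ a b = ℚP.toℚᵘ-injective (ℚᵘP.≃-trans viaᵘ (ℚᵘP.≃-sym (ℚP.toℚᵘ-homo-+ (toℚ a) (toℚ b))))
    where
    viaᵘ : ℚ.toℚᵘ (toℚ (a + b)) ℚᵘ.≃ (ℚ.toℚᵘ (toℚ a) ℚᵘ.+ ℚ.toℚᵘ (toℚ b))
    viaᵘ rewrite toℚᵘ-toℚ (a + b) | toℚᵘ-toℚ a | toℚᵘ-toℚ b = ℚᵘ.*≡* (identity a b)
      where
      identity : ∀ a b → (a + b) * (+ 1 * + 1) ≡ (a * + 1 + b * + 1) * + 1
      identity = solve-∀

  toℚ-* : ∀ a b → toℚ (a * b) ≡ toℚ a ℚ.* toℚ b
  toℚ-* a b = ℚP.toℚᵘ-injective (ℚᵘP.≃-trans viaᵘ (ℚᵘP.≃-sym (ℚP.toℚᵘ-homo-* (toℚ a) (toℚ b))))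
    where
    viaᵘ : ℚ.toℚᵘ (toℚ (a * b)) ℚᵘ.≃ (ℚ.toℚᵘ (toℚ a) ℚᵘ.* ℚ.toℚᵘ (toℚ b))
    viaᵘ rewrite toℚᵘ-toℚ (a * b) | toℚᵘ-toℚ a | toℚᵘ-toℚ b = ℚᵘ.*≡* (identity a b)
      where
      identity : ∀ a b → (a * b) * (+ 1 * + 1) ≡ (a * b) * + 1
      identity = solve-∀

  toℚ-mono-≤ : ∀ {a b} → a ≤ b → toℚ a ℚ.≤ toℚ b
  toℚ-mono-≤ {a} {b} h = ℚP.toℚᵘ-cancel-≤ viaᵘ
    where
    viaᵘ : ℚ.toℚᵘ (toℚ a) ℚᵘ.≤ ℚ.toℚᵘ (toℚ b)
    viaᵘ rewrite toℚᵘ-toℚ a | toℚᵘ-toℚ b = ℚᵘ.*≤* (ℤP.*-monoʳ-≤-nonNeg (+ 1) h)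

  p≤∣p∣ : ∀ p → p ℚ.≤ ℚ.∣ p ∣
  p≤∣p∣ p with ℚP.≤-total 0ℚ p
  ... | inj₁ 0≤p = ℚP.≤-reflexive (sym (ℚP.0≤p⇒∣p∣≡p 0≤p))
  ... | inj₂ p≤0 = ℚP.≤-trans p≤0 (ℚP.0≤∣p∣ p)

  module WeightedSum {S : Set} (p : S → ℚ) where
    open +-*-Solver

    weightedSum : (S → ℤ) → List S → ℚ
    weightedSum f ws = sumℚ (L.map (λ w → p w ℚ.* toℚ (f w)) ws)

    weightedSum-cong : ∀ {f g : S → ℤ} → (∀ w → f w ≡ g w) → ∀ ws → weightedSum f ws ≡ weightedSum g ws
    weightedSum-cong h [] = refl
    weightedSum-cong h (w ∷ ws) = cong₂ ℚ._+_ (cong (λ z → p w ℚ.* toℚ z) (h w)) (weightedSum-cong h ws)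

    weightedSum-+ : ∀ (f g : S → ℤ) ws → weightedSum (λ w → f w + g w) ws ≡ weightedSum f ws ℚ.+ weightedSum g ws
    weightedSum-+ f g [] = refl
    weightedSum-+ f g (w ∷ ws) =
      trans (cong₂ ℚ._+_ (cong (p w ℚ.*_) (toℚ-+ (f w) (g w))) (weightedSum-+ f g ws))
            (regroup (p w) (toℚ (f w)) (toℚ (g w)) (weightedSum f ws) (weightedSum g ws))
      where
      regroup : ∀ (a x y u v : ℚ) → a ℚ.* (x ℚ.+ y) ℚ.+ (u ℚ.+ v) ≡ (a ℚ.* x ℚ.+ u) ℚ.+ (a ℚ.* y ℚ.+ v)
      regroup = solve 5 (λ a x y u v → a :* (x :+ y) :+ (u :+ v) := (a :* x :+ u) :+ (a :* y :+ v)) refl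

    weightedSum-* : ∀ (c : ℤ) (f : S → ℤ) ws → weightedSum (λ w → c * f w) ws ≡ toℚ c ℚ.* weightedSum f ws
    weightedSum-* c f [] = sym (ℚP.*-zeroʳ (toℚ c))
    weightedSum-* c f (w ∷ ws) =
      trans (cong₂ ℚ._+_ (cong (p w ℚ.*_) (toℚ-* c (f w))) (weightedSum-* c f ws))
            (regroup (p w) (toℚ c) (toℚ (f w)) (weightedSum f ws))
      where
      regroup : ∀ (a c x u : ℚ) → a ℚ.* (c ℚ.* x) ℚ.+ c ℚ.* u ≡ c ℚ.* (a ℚ.* x ℚ.+ u)
      regroup = solve 4 (λ a c x u → a :* (c :* x) :+ c :* u := c :* (a :* x :+ u)) refl

    weightedSum-zero : ∀ ws → weightedSum (λ _ → + 0) ws ≡ 0ℚ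
    weightedSum-zero [] = refl
    weightedSum-zero (w ∷ ws) = trans (cong₂ ℚ._+_ (ℚP.*-zeroʳ (p w)) (weightedSum-zero ws)) (ℚP.+-identityʳ 0ℚ)

    weightedSum-one : ∀ ws → weightedSum (λ _ → + 1) ws ≡ sumℚ (L.map p ws)
    weightedSum-one [] = refl
    weightedSum-one (w ∷ ws) = cong₂ ℚ._+_ (ℚP.*-identityʳ (p w)) (weightedSum-one ws)

    module ExpBounds (δ : ℚ) (ws : List S) where

      ExpBound : (S → ℤ) → ℤ → ℤ → Set
      ExpBound f a b = weightedSum f ws ℚ.≤ toℚ a ℚ.+ δ ℚ.* toℚ b

      ExpBound-cong : ∀ {f g : S → ℤ} {a b} → (∀ w → f w ≡ g w) → ExpBound f a b → ExpBound g a b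
      ExpBound-cong h bd = subst (ℚ._≤ _) (weightedSum-cong h ws) bd

      ExpBound-∑ : ∀ {k} (f : Fin k → S → ℤ) (a b : Fin k → ℤ) → (∀ i → ExpBound (f i) (a i) (b i)) →
        ExpBound (λ w → ∑ (λ i → f i w)) (∑ a) (∑ b)
      ExpBound-∑ {zero} f a b h = ℚP.≤-reflexive (trans (weightedSum-zero ws) (zero≡ δ))
        where
        zero≡ : ∀ (d : ℚ) → 0ℚ ≡ 0ℚ ℚ.+ d ℚ.* 0ℚ
        zero≡ = solve 1 (λ d → con 0ℚ := con 0ℚ :+ d :* con 0ℚ) refl
      ExpBound-∑ {suc k} f a b h = begin
        weightedSum (λ w → f F.zero w + ∑ (λ i → f (F.suc i) w)) ws
          ≡⟨ weightedSum-+ (f F.zero) _ ws ⟩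
        weightedSum (f F.zero) ws ℚ.+ weightedSum (λ w → ∑ (λ i → f (F.suc i) w)) ws
          ≤⟨ ℚP.+-mono-≤ (h F.zero) (ExpBound-∑ (f ∘ F.suc) (a ∘ F.suc) (b ∘ F.suc) (h ∘ F.suc)) ⟩
        (toℚ a₀ ℚ.+ δ ℚ.* toℚ b₀) ℚ.+ (toℚ a′ ℚ.+ δ ℚ.* toℚ b′)
          ≡⟨ regroup δ (toℚ a₀) (toℚ b₀) (toℚ a′) (toℚ b′) ⟩
        (toℚ a₀ ℚ.+ toℚ a′) ℚ.+ δ ℚ.* (toℚ b₀ ℚ.+ toℚ b′)
          ≡⟨ sym (cong₂ (λ x y → x ℚ.+ δ ℚ.* y) (toℚ-+ a₀ a′) (toℚ-+ b₀ b′)) ⟩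
        toℚ (∑ a) ℚ.+ δ ℚ.* toℚ (∑ b) ∎
        where
        open ℚP.≤-Reasoning
        a₀ = a F.zero
        b₀ = b F.zero
        a′ = ∑ (a ∘ F.suc)
        b′ = ∑ (b ∘ F.suc)
        regroup : ∀ (d x y u v : ℚ) → (x ℚ.+ d ℚ.* y) ℚ.+ (u ℚ.+ d ℚ.* v) ≡ (x ℚ.+ u) ℚ.+ d ℚ.* (y ℚ.+ v)
        regroup = solve 5 (λ d x y u v → (x :+ d :* y) :+ (u :+ d :* v) := (x :+ u) :+ d :* (y :+ v)) refl

      ExpBound-scale : ∀ (c : ℤ) (f : S → ℤ) a b → + 0 ≤ c → ExpBound f a b →
        ExpBound (λ w → c * f w) (c * a) (c * b)
      ExpBound-scale c f a b c≥0 bd = begin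
        weightedSum (λ w → c * f w) ws             ≡⟨ weightedSum-* c f ws ⟩
        toℚ c ℚ.* weightedSum f ws                 ≤⟨ ℚP.*-monoˡ-≤-nonNeg (toℚ c) {{ℚ.nonNegative (toℚ-mono-≤ c≥0)}} bd ⟩
        toℚ c ℚ.* (toℚ a ℚ.+ δ ℚ.* toℚ b)          ≡⟨ distribute (toℚ c) (toℚ a) δ (toℚ b) ⟩
        toℚ c ℚ.* toℚ a ℚ.+ δ ℚ.* (toℚ c ℚ.* toℚ b)
          ≡⟨ sym (cong₂ (λ x y → x ℚ.+ δ ℚ.* y) (toℚ-* c a) (toℚ-* c b)) ⟩
        toℚ (c * a) ℚ.+ δ ℚ.* toℚ (c * b)          ∎
        where
        open ℚP.≤-Reasoning
        distribute : ∀ (c a d b : ℚ) → c ℚ.* (a ℚ.+ d ℚ.* b) ≡ c ℚ.* a ℚ.+ d ℚ.* (c ℚ.* b)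
        distribute = solve 4 (λ c a d b → c :* (a :+ d :* b) := c :* a :+ d :* (c :* b)) refl

  -- Walks and hikes

  module _ {n : ℕ} where

    lastFrom : Fin n → List (Fin n) → Fin n
    lastFrom x [] = x
    lastFrom x (y ∷ ys) = lastFrom y ys

    last≡lastFrom : ∀ {k} x (v : Vec (Fin n) k) → V.last (x ∷ v) ≡ lastFrom x (V.toList v)
    last≡lastFrom x [] = refl
    last≡lastFrom x (y ∷ v) = last≡lastFrom y v

    lastFrom-++ : ∀ x (U W : List (Fin n)) → lastFrom x (U ++ W) ≡ lastFrom (lastFrom x U) W
    lastFrom-++ x [] W = refl
    lastFrom-++ x (u ∷ U) W = lastFrom-++ u U W

    steps-++ : ∀ x (U W : List (Fin n)) → steps (x ∷ (U ++ W)) ≡ steps (x ∷ U) ++ steps (lastFrom x U ∷ W)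
    steps-++ x [] W = refl
    steps-++ x (u ∷ U) W = cong ((x , u) ∷_) (steps-++ u U W)

    length-steps : ∀ x (U : List (Fin n)) → L.length (steps (x ∷ U)) ≡ L.length U
    length-steps x [] = refl
    length-steps x (u ∷ U) = cong suc (length-steps u U)

    stepsFwd≡steps : ∀ {k} p (bs : Vec (Fin n) k) → stepsFwd p bs ≡ steps (proj₂ p ∷ V.toList bs)
    stepsFwd≡steps p [] = refl
    stepsFwd≡steps p (b ∷ bs) = cong ((proj₂ p , b) ∷_) (stepsFwd≡steps (proj₂ p , b) bs)

    stepsBwd≡steps : ∀ {k} q (as : Vec (Fin n) k) →
      stepsBwd q as ++ (endBwd q as ∷ []) ≡ q ∷ L.map swap (steps (proj₁ q ∷ V.toList as))
    stepsBwd≡steps q [] = refl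
    stepsBwd≡steps q (a ∷ as) = cong (q ∷_) (stepsBwd≡steps (a , proj₁ q) as)

    endFwd-∷ʳ : ∀ {k} p (u : Vec (Fin n) k) z → endFwd p (u V.∷ʳ z) ≡ (lastFrom (proj₂ p) (V.toList u) , z)
    endFwd-∷ʳ p [] z = refl
    endFwd-∷ʳ p (x ∷ u) z = endFwd-∷ʳ (proj₂ p , x) u z

    proj₁-endBwd : ∀ {k} q (as : Vec (Fin n) k) → proj₁ (endBwd q as) ≡ lastFrom (proj₁ q) (V.toList as)
    proj₁-endBwd q [] = refl
    proj₁-endBwd q (a ∷ as) = proj₁-endBwd (a , proj₁ q) as

    noReversalᵛ : List (Fin n) → Bool
    noReversalᵛ (a ∷ b ∷ c ∷ r) = not (c == a) ∧ noReversalᵛ (b ∷ c ∷ r)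
    noReversalᵛ _ = true

    noReversalᵛ-tail : ∀ a W → noReversalᵛ (a ∷ W) ≡ true → noReversalᵛ W ≡ true
    noReversalᵛ-tail a [] h = refl
    noReversalᵛ-tail a (b ∷ []) h = refl
    noReversalᵛ-tail a (b ∷ c ∷ r) h = proj₂ (∧-true⁻ {not (c == a)} h)

    noReversalᵛ-prefix : ∀ W₁ W₂ → noReversalᵛ (W₁ ++ W₂) ≡ true → noReversalᵛ W₁ ≡ true
    noReversalᵛ-prefix [] W₂ h = refl
    noReversalᵛ-prefix (a ∷ []) W₂ h = refl
    noReversalᵛ-prefix (a ∷ b ∷ []) W₂ h = refl
    noReversalᵛ-prefix (a ∷ b ∷ c ∷ r) W₂ h =
      let c≢a , h-rest = ∧-true⁻ {not (c == a)} h in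
      ∧-true⁺ c≢a (noReversalᵛ-prefix (b ∷ c ∷ r) W₂ h-rest)

    noReversal : List (Fin n × Fin n) → Bool
    noReversal (s ∷ t ∷ r) = not (stepEq t (swap s)) ∧ noReversal (t ∷ r)
    noReversal _ = true

    noReversalᵛ⇒noReversal : ∀ W → noReversalᵛ W ≡ true → noReversal (steps W) ≡ true
    noReversalᵛ⇒noReversal [] h = refl
    noReversalᵛ⇒noReversal (a ∷ []) h = refl
    noReversalᵛ⇒noReversal (a ∷ b ∷ []) h = refl
    noReversalᵛ⇒noReversal (a ∷ b ∷ c ∷ r) h =
      let c≢a , h-rest = ∧-true⁻ {not (c == a)} h in
      ∧-true⁺ (not-∧ʳ (b == b) c≢a) (noReversalᵛ⇒noReversal (b ∷ c ∷ r) h-rest)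
      where
      not-∧ʳ : ∀ x {y} → not y ≡ true → not (x ∧ y) ≡ true
      not-∧ʳ true h = h
      not-∧ʳ false _ = refl

    noReversal⇒nbExcept : ∀ k i S → noReversal S ≡ true → nbExcept k i S ≡ true
    noReversal⇒nbExcept k i [] h = refl
    noReversal⇒nbExcept k i (s ∷ []) h = refl
    noReversal⇒nbExcept k i (s ∷ t ∷ r) h =
      let t≢s , h-rest = ∧-true⁻ {not (stepEq t (swap s))} h in
      ∧-true⁺ (trans (cong ((i ≡ᵇ k) ∨_) t≢s) (BP.∨-zeroʳ _)) (noReversal⇒nbExcept k (suc i) (t ∷ r) h-rest)

    ≡ᵇ-refl : ∀ i → (i ≡ᵇ i) ≡ true
    ≡ᵇ-refl i = Equivalence.to BP.T-≡ (ℕP.≡⇒≡ᵇ i i refl)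

    -- Joining two step lists without reversals: the only possible reversal is at the
    -- junction, which is the permitted k-th one when the first list ends at step k.
    nbExcept-++ : ∀ k i S₁ S₂ → noReversal S₁ ≡ true → noReversal S₂ ≡ true →
      i ℕ.+ L.length S₁ ≡ suc k → nbExcept k i (S₁ ++ S₂) ≡ true
    nbExcept-++ k i [] S₂ h₁ h₂ eq = noReversal⇒nbExcept k i S₂ h₂
    nbExcept-++ k i (s ∷ []) [] h₁ h₂ eq = refl
    nbExcept-++ k i (s ∷ []) (t ∷ r) h₁ h₂ eq
      rewrite sym (ℕP.suc-injective (trans (ℕP.+-comm 1 i) eq)) | ≡ᵇ-refl i = noReversal⇒nbExcept i (suc i) (t ∷ r) h₂
    nbExcept-++ k i (s ∷ t ∷ r) S₂ h₁ h₂ eq =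
      let t≢s , h-rest = ∧-true⁻ {not (stepEq t (swap s))} h₁ in
      ∧-true⁺ (trans (cong ((i ≡ᵇ k) ∨_) t≢s) (BP.∨-zeroʳ _))
              (nbExcept-++ k (suc i) (t ∷ r) S₂ h-rest h₂ (trans (sym (ℕP.+-suc i _)) eq))

  allᵇ-true : ∀ {A : Set} (P : A → Bool) xs → (∀ x → P x ≡ true) → allᵇ P xs ≡ true
  allᵇ-true P [] h = refl
  allᵇ-true P (x ∷ xs) h = ∧-true⁺ (h x) (allᵇ-true P xs h)

  module Hikes {n} (G : Graph n) where
    open EdgeIndexing G
    open Parity G

    -- isHike and isEvenWalk of Defs, for the walk x ∷ W
    isHikeFrom : ℕ → Fin n → List (Fin n) → Bool
    isHikeFrom m x W = (x == lastFrom x W) ∧ (allAdjacent (steps (x ∷ W)) ∧ nbExcept m 1 (steps (x ∷ W)))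

    isEvenFrom : Fin n → List (Fin n) → Bool
    isEvenFrom x W = allᵇ (λ ab → isEvenℕ (traversals (proj₁ ab) (proj₂ ab) (steps (x ∷ W)))) (allPairs n)

    allAdjacent-++ : ∀ S T → allAdjacent (S ++ T) ≡ (allAdjacent S ∧ allAdjacent T)
    allAdjacent-++ [] T = refl
    allAdjacent-++ (s ∷ S) T = trans (cong (adj G (proj₁ s) (proj₂ s) ∧_) (allAdjacent-++ S T))
                                     (sym (BP.∧-assoc (adj G (proj₁ s) (proj₂ s)) (allAdjacent S) (allAdjacent T)))

    allAdjacent-swap : ∀ S → allAdjacent S ≡ true → allAdjacent (L.map swap S) ≡ true
    allAdjacent-swap [] h = refl
    allAdjacent-swap (s ∷ S) h =
      let adj-s , adj-S = ∧-true⁻ {adj G (proj₁ s) (proj₂ s)} h in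
      ∧-true⁺ (trans (Graph.sym G (proj₂ s) (proj₁ s)) adj-s) (allAdjacent-swap S adj-S)

    validFwd⇒walk : ∀ {k} p (bs : Vec (Fin n) k) → validFwd G p bs ≡ true →
      allAdjacent (steps (proj₂ p ∷ V.toList bs)) ≡ true × noReversalᵛ (proj₁ p ∷ proj₂ p ∷ V.toList bs) ≡ true
    validFwd⇒walk p [] h = refl , refl
    validFwd⇒walk p (b ∷ bs) h =
      let adj-b , rest = ∧-true⁻ {adj G (proj₂ p) b} h
          follows-b , valid = ∧-true⁻ {follows p (proj₂ p , b)} rest
          adj-bs , noRev-bs = validFwd⇒walk (proj₂ p , b) bs valid
      in ∧-true⁺ adj-b adj-bs , ∧-true⁺ (proj₂ (∧-true⁻ {proj₂ p == proj₂ p} follows-b)) noRev-bs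

    validBwd⇒walk : ∀ {k} q (as : Vec (Fin n) k) → validBwd G q as ≡ true →
      allAdjacent (steps (proj₁ q ∷ V.toList as)) ≡ true × noReversalᵛ (proj₂ q ∷ proj₁ q ∷ V.toList as) ≡ true
    validBwd⇒walk q [] h = refl , refl
    validBwd⇒walk q (a ∷ as) h =
      let adj-a , rest = ∧-true⁻ {adj G a (proj₁ q)} h
          follows-a , valid = ∧-true⁻ {follows (a , proj₁ q) q} rest
          adj-as , noRev-as = validBwd⇒walk (a , proj₁ q) as valid
          noRev-a = trans (cong not (==-sym a (proj₂ q))) (proj₂ (∧-true⁻ {proj₁ q == proj₁ q} follows-a))
      in ∧-true⁺ (trans (Graph.sym G (proj₁ q) a) adj-a) adj-as , ∧-true⁺ noRev-a noRev-as

    traverses≡pairEq : ∀ a b (s : Fin n × Fin n) →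
      (stepEq s (a , b) ∨ stepEq s (b , a)) ≡ pairEq (sortPair s) (sortPair (a , b))
    traverses≡pairEq a b s = Bool-ext to from
      where
      to : (stepEq s (a , b) ∨ stepEq s (b , a)) ≡ true → pairEq (sortPair s) (sortPair (a , b)) ≡ true
      to h with ∨-true⁻ {stepEq s (a , b)} h
      ... | inj₁ h₁ rewrite pairEq⇒≡ s (a , b) h₁ = pairEq-refl (sortPair (a , b))
      ... | inj₂ h₂ rewrite pairEq⇒≡ s (b , a) h₂ | sortPair-swap (a , b) = pairEq-refl (sortPair (a , b))
      from : pairEq (sortPair s) (sortPair (a , b)) ≡ true → (stepEq s (a , b) ∨ stepEq s (b , a)) ≡ true
      from h with sortPair-injective s (a , b) (pairEq⇒≡ _ _ h)
      ... | inj₁ refl rewrite pairEq-refl (a , b) = refl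
      ... | inj₂ refl rewrite pairEq-refl (b , a) = BP.∨-zeroʳ _

    traversals≡crossings : ∀ a b S → traversals a b S ≡ crossings (sortPair (a , b)) S
    traversals≡crossings a b [] = refl
    traversals≡crossings a b (s ∷ S) rewrite sym (traverses≡pairEq a b s)
      with stepEq s (a , b) ∨ stepEq s (b , a)
    ... | true = cong suc (traversals≡crossings a b S)
    ... | false = traversals≡crossings a b S

    crossings-nonEdge : ∀ a b S → allAdjacent S ≡ true → adj G a b ≡ false → crossings (sortPair (a , b)) S ≡ 0
    crossings-nonEdge a b [] h ¬ab = refl
    crossings-nonEdge a b (s ∷ S) h ¬ab with ∧-true⁻ {adj G (proj₁ s) (proj₂ s)} h
    ... | adj-s , adj-S with pairEq (sortPair s) (sortPair (a , b)) in eq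
    ... | false = crossings-nonEdge a b S adj-S ¬ab
    ... | true with sortPair-injective s (a , b) (pairEq⇒≡ _ _ eq)
    ... | inj₁ refl with trans (sym adj-s) ¬ab
    ... | ()
    crossings-nonEdge a b (s ∷ S) h ¬ab | adj-s , adj-S | true | inj₂ refl
      with trans (sym (trans (Graph.sym G a b) adj-s)) ¬ab
    ... | ()

    crossings-++ : ∀ k S T → crossings k (S ++ T) ≡ crossings k S ℕ.+ crossings k T
    crossings-++ k [] T = refl
    crossings-++ k (s ∷ S) T with pairEq (sortPair s) k
    ... | true = cong suc (crossings-++ k S T)
    ... | false = crossings-++ k S T

    crossings-swap : ∀ k S → crossings k (L.map swap S) ≡ crossings k S
    crossings-swap k [] = refl
    crossings-swap k (s ∷ S) rewrite sortPair-swap s with pairEq (sortPair s) k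
    ... | true = cong suc (crossings-swap k S)
    ... | false = crossings-swap k S

    isEvenFrom-intro : ∀ x W S → allAdjacent (steps (x ∷ W)) ≡ true →
      (∀ k → isEvenℕ (crossings k S) ≡ isEvenℕ (crossings k (steps (x ∷ W)))) →
      (∀ e → isEvenℕ (crossings (edge G e) S) ≡ true) → isEvenFrom x W ≡ true
    isEvenFrom-intro x W S walk parity even = allᵇ-true _ (allPairs n) at
      where
      at : ∀ ab → isEvenℕ (traversals (proj₁ ab) (proj₂ ab) (steps (x ∷ W))) ≡ true
      at (a , b) rewrite traversals≡crossings a b (steps (x ∷ W)) with adj G a b in adj-ab
      ... | false rewrite crossings-nonEdge a b (steps (x ∷ W)) walk adj-ab = refl
      ... | true =
        let I = edgeIndex (a , b) adj-ab
            e = EdgeIndex.index I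
        in subst (λ k → isEvenℕ (crossings k (steps (x ∷ W))) ≡ true) (EdgeIndex.index-edge I)
                 (trans (sym (parity (edge G e))) (even e))

    pathSteps-split : ∀ {m} x₀ x₁ (u : Vec (Fin n) m) z (as : Vec (Fin n) m) →
      let y = lastFrom x₁ (V.toList u) in
      pathSteps (x₀ , x₁) (u V.∷ʳ z) as
        ≡ (steps (x₁ ∷ V.toList u) ++ ((y , z) ∷ [])) ++ ((y , z) ∷ L.map swap (steps (y ∷ V.toList as)))
    pathSteps-split x₀ x₁ u z as rewrite endFwd-∷ʳ (x₀ , x₁) u z =
      cong₂ _++_ forward (stepsBwd≡steps (lastFrom x₁ (V.toList u) , z) as)
      where
      forward : stepsFwd (x₀ , x₁) (u V.∷ʳ z) ≡ steps (x₁ ∷ V.toList u) ++ ((lastFrom x₁ (V.toList u) , z) ∷ [])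
      forward = begin
        stepsFwd (x₀ , x₁) (u V.∷ʳ z)       ≡⟨ stepsFwd≡steps (x₀ , x₁) (u V.∷ʳ z) ⟩
        steps (x₁ ∷ V.toList (u V.∷ʳ z))    ≡⟨ cong (λ l → steps (x₁ ∷ l)) (VP.toList-∷ʳ z u) ⟩
        steps (x₁ ∷ (V.toList u ++ z ∷ [])) ≡⟨ steps-++ x₁ (V.toList u) (z ∷ []) ⟩
        steps (x₁ ∷ V.toList u) ++ ((lastFrom x₁ (V.toList u) , z) ∷ []) ∎
        where open ≡-Reasoning

    pathSteps-parity : ∀ {m} x₀ x₁ (u : Vec (Fin n) m) z (as : Vec (Fin n) m) k →
      isEvenℕ (crossings k (pathSteps (x₀ , x₁) (u V.∷ʳ z) as))
        ≡ isEvenℕ (crossings k (steps (x₁ ∷ (V.toList u ++ V.toList as))))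
    pathSteps-parity x₀ x₁ u z as k = begin
      isEvenℕ (c (pathSteps (x₀ , x₁) (u V.∷ʳ z) as))              ≡⟨ cong (isEvenℕ ∘ c) (pathSteps-split x₀ x₁ u z as) ⟩
      isEvenℕ (c ((Fw ++ (t ∷ [])) ++ (t ∷ L.map swap Bw)))         ≡⟨ cong isEvenℕ split-count ⟩
      isEvenℕ ((c Fw ℕ.+ c (t ∷ [])) ℕ.+ (c (t ∷ []) ℕ.+ c Bw))     ≡⟨ cong isEvenℕ (regroup (c Fw) (c (t ∷ [])) (c Bw)) ⟩
      isEvenℕ ((c (t ∷ []) ℕ.+ c (t ∷ [])) ℕ.+ (c Fw ℕ.+ c Bw))     ≡⟨ isEvenℕ-+-double (c (t ∷ [])) _ ⟩
      isEvenℕ (c Fw ℕ.+ c Bw)                                       ≡⟨ cong isEvenℕ (sym (crossings-++ k Fw Bw)) ⟩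
      isEvenℕ (c (Fw ++ Bw))                                        ≡⟨ cong (isEvenℕ ∘ c) (sym (steps-++ x₁ U As)) ⟩
      isEvenℕ (c (steps (x₁ ∷ (U ++ As))))                          ∎
      where
      open ≡-Reasoning
      U = V.toList u
      As = V.toList as
      y = lastFrom x₁ U
      t = (y , z)
      Fw = steps (x₁ ∷ U)
      Bw = steps (y ∷ As)
      c = crossings k
      twice : c (t ∷ L.map swap Bw) ≡ c (t ∷ []) ℕ.+ c Bw
      twice with pairEq (sortPair t) k
      ... | true = cong suc (crossings-swap k Bw)
      ... | false = crossings-swap k Bw
      split-count : c ((Fw ++ (t ∷ [])) ++ (t ∷ L.map swap Bw)) ≡ (c Fw ℕ.+ c (t ∷ [])) ℕ.+ (c (t ∷ []) ℕ.+ c Bw)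
      split-count = trans (crossings-++ k (Fw ++ (t ∷ [])) _) (cong₂ ℕ._+_ (crossings-++ k Fw (t ∷ [])) twice)
      regroup : ∀ a t b → (a ℕ.+ t) ℕ.+ (t ℕ.+ b) ≡ (t ℕ.+ t) ℕ.+ (a ℕ.+ b)
      regroup = ℕ-Solver.solve-∀

    validPath⇒hike : ∀ {m} x₀ x₁ (u : Vec (Fin n) m) z (as : Vec (Fin n) m) →
      validPath G (x₀ , x₁) (u V.∷ʳ z) as ≡ true →
      let W = V.toList u ++ V.toList as in
      (adj G (lastFrom x₁ (V.toList u)) z ≡ true) × (isHikeFrom m x₁ W ≡ true)
        × (allAdjacent (pathSteps (x₀ , x₁) (u V.∷ʳ z) as) ≡ true)
    validPath⇒hike {m} x₀ x₁ u z as valid = adj-yz , ∧-true⁺ closed (∧-true⁺ walk-adj walk-nb) , path-adj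
      where
      U = V.toList u
      As = V.toList as
      y = lastFrom x₁ U
      p = (x₀ , x₁)
      bs = u V.∷ʳ z
      validF = proj₁ (∧-true⁻ {validFwd G p bs} valid)
      validB,closes = ∧-true⁻ {validBwd G (endFwd p bs) as} (proj₂ (∧-true⁻ {validFwd G p bs} valid))
      validB : validBwd G (y , z) as ≡ true
      validB = subst (λ q → validBwd G q as ≡ true) (endFwd-∷ʳ p u z) (proj₁ validB,closes)
      closes : follows p (endBwd (y , z) as) ≡ true
      closes = subst (λ q → follows p (endBwd q as) ≡ true) (endFwd-∷ʳ p u z) (proj₂ validB,closes)
      fwd = validFwd⇒walk p bs validF
      bwd = validBwd⇒walk (y , z) as validB
      fwd-adj : allAdjacent (steps (x₁ ∷ U) ++ ((y , z) ∷ [])) ≡ true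
      fwd-adj = subst (λ l → allAdjacent l ≡ true) (steps-++ x₁ U (z ∷ []))
                      (subst (λ l → allAdjacent (steps (x₁ ∷ l)) ≡ true) (VP.toList-∷ʳ z u) (proj₁ fwd))
      fwd-adj′ = ∧-true⁻ {allAdjacent (steps (x₁ ∷ U))} (trans (sym (allAdjacent-++ (steps (x₁ ∷ U)) _)) fwd-adj)
      adj-yz : adj G y z ≡ true
      adj-yz = proj₁ (∧-true⁻ {adj G y z} (proj₂ fwd-adj′))
      fwd-noRev : noReversalᵛ (x₁ ∷ U) ≡ true
      fwd-noRev = noReversalᵛ-prefix (x₁ ∷ U) (z ∷ []) (noReversalᵛ-tail x₀ (x₁ ∷ (U ++ z ∷ []))
                    (subst (λ l → noReversalᵛ (x₀ ∷ x₁ ∷ l) ≡ true) (VP.toList-∷ʳ z u) (proj₂ fwd)))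
      bwd-noRev : noReversalᵛ (y ∷ As) ≡ true
      bwd-noRev = noReversalᵛ-tail z (y ∷ As) (proj₂ bwd)
      closed : (x₁ == lastFrom x₁ (U ++ As)) ≡ true
      closed = trans (cong (x₁ ==_) (trans (lastFrom-++ x₁ U As) (sym (proj₁-endBwd (y , z) as))))
                     (proj₁ (∧-true⁻ {x₁ == proj₁ (endBwd (y , z) as)} closes))
      walk-adj : allAdjacent (steps (x₁ ∷ (U ++ As))) ≡ true
      walk-adj rewrite steps-++ x₁ U As | allAdjacent-++ (steps (x₁ ∷ U)) (steps (y ∷ As)) =
        ∧-true⁺ (proj₁ fwd-adj′) (proj₁ bwd)
      walk-nb : nbExcept m 1 (steps (x₁ ∷ (U ++ As))) ≡ true
      walk-nb rewrite steps-++ x₁ U As =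
        nbExcept-++ m 1 (steps (x₁ ∷ U)) (steps (y ∷ As))
          (noReversalᵛ⇒noReversal (x₁ ∷ U) fwd-noRev) (noReversalᵛ⇒noReversal (y ∷ As) bwd-noRev)
          (cong suc (trans (length-steps x₁ U) (VP.length-toList u)))
      path-adj : allAdjacent (pathSteps p bs as) ≡ true
      path-adj rewrite pathSteps-split x₀ x₁ u z as
                     | allAdjacent-++ (steps (x₁ ∷ U) ++ ((y , z) ∷ [])) ((y , z) ∷ L.map swap (steps (y ∷ As))) =
        ∧-true⁺ fwd-adj (∧-true⁺ adj-yz (allAdjacent-swap (steps (y ∷ As)) (proj₁ bwd)))

  -- Bounding the expected trace

  module PathBound {n} (G : Graph n) (p : Signing G → ℚ) (δ : ℚ) (m : ℕ)
                   (dist : IsDistribution G p) (wise : WiseUniform G p δ (2 ℕ.* suc m)) where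
    open EdgeIndexing G
    open Parity G
    open Hikes G
    open WeightedSum p
    open ExpBounds δ (allSignings G)

    δ-nonneg : ∀ a b → adj G a b ≡ true → 0ℚ ℚ.≤ δ
    δ-nonneg a b h = ℚP.≤-trans (ℚP.0≤∣p∣ _) (wise ⁅ e ⁆ (ℕP.≤-reflexive (sym ∣⁅e⁆∣≡1)) ∣⁅e⁆∣≤2m+2)
      where
      e = EdgeIndex.index (edgeIndex (a , b) h)
      ∣⁅e⁆∣≡1 = SubP.∣⁅x⁆∣≡1 e
      ∣⁅e⁆∣≤2m+2 = ℕP.≤-trans (ℕP.≤-reflexive ∣⁅e⁆∣≡1) (ℕ.s≤s ℕ.z≤n)

    prodOver-bound : ∀ S → ∣ S ∣ ℕ.≤ 2 ℕ.* suc m → 0ℚ ℚ.≤ δ →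
      weightedSum (prodOver G S) (allSignings G) ℚ.≤ toℚ (𝟙 (∣ S ∣ ≡ᵇ 0)) ℚ.+ δ
    prodOver-bound S small δ≥0 with ∣ S ∣ in size
    ... | zero = begin
      weightedSum (prodOver G S) (allSignings G) ≡⟨ weightedSum-cong (λ w → prodOver-empty G S w size) (allSignings G) ⟩
      weightedSum (λ _ → + 1) (allSignings G)    ≡⟨ trans (weightedSum-one (allSignings G)) (proj₂ dist) ⟩
      1ℚ                                         ≡⟨ sym (ℚP.+-identityʳ 1ℚ) ⟩
      1ℚ ℚ.+ 0ℚ                                  ≤⟨ ℚP.+-monoʳ-≤ 1ℚ δ≥0 ⟩
      1ℚ ℚ.+ δ                                   ∎
      where open ℚP.≤-Reasoning
    ... | suc c = begin
      weightedSum (prodOver G S) (allSignings G) ≤⟨ p≤∣p∣ _ ⟩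
      ℚ.∣ 𝔼 G p (prodOver G S) ∣
        ≤⟨ wise S (subst (1 ℕ.≤_) (sym size) (ℕ.s≤s ℕ.z≤n)) (subst (ℕ._≤ _) (sym size) small) ⟩
      δ                                          ≡⟨ sym (ℚP.+-identityˡ δ) ⟩
      0ℚ ℚ.+ δ                                   ∎
      where open ℚP.≤-Reasoning

    length-pathSteps : ∀ q (bs : Vec (Fin n) (suc m)) (as : Vec (Fin n) m) →
      L.length (pathSteps q bs as) ≡ 2 ℕ.* suc m
    length-pathSteps q bs as = begin
      L.length (stepsFwd q bs ++ (stepsBwd r as ++ (endBwd r as ∷ [])))
        ≡⟨ LP.length-++ (stepsFwd q bs) ⟩
      L.length (stepsFwd q bs) ℕ.+ L.length (stepsBwd r as ++ (endBwd r as ∷ []))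
        ≡⟨ cong₂ ℕ._+_ (length-stepsFwd q bs) (trans (LP.length-++ (stepsBwd r as)) (cong (ℕ._+ 1) (length-stepsBwd r as))) ⟩
      suc m ℕ.+ (m ℕ.+ 1)
        ≡⟨ count m ⟩
      2 ℕ.* suc m ∎
      where
      open ≡-Reasoning
      r = endFwd q bs
      count : ∀ m → suc m ℕ.+ (m ℕ.+ 1) ≡ 2 ℕ.* suc m
      count = ℕ-Solver.solve-∀

    pathWeight-bound : ∀ x₀ x₁ (u : Vec (Fin n) m) z (as : Vec (Fin n) m) →
      let valid = validPath G (x₀ , x₁) (u V.∷ʳ z) as in
      ExpBound (λ w → pathWeight G w (x₀ , x₁) (u V.∷ʳ z) as)
               (𝟙 valid * 𝟙 (isEvenFrom x₁ (V.toList u ++ V.toList as))) (𝟙 valid)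
    pathWeight-bound x₀ x₁ u z as =
      ExpBound-cong {a = 𝟙 valid * 𝟙 (isEvenFrom x₁ W)} {b = 𝟙 valid}
                    (λ w → sym (pathWeight≡ G w (x₀ , x₁) bs as)) (by-validity valid refl)
      where
      bs = u V.∷ʳ z
      valid = validPath G (x₀ , x₁) bs as
      S = pathSteps (x₀ , x₁) bs as
      W = V.toList u ++ V.toList as
      by-validity : ∀ v → validPath G (x₀ , x₁) bs as ≡ v →
        weightedSum (λ w → 𝟙 v * signProduct G w S) (allSignings G)
          ℚ.≤ toℚ (𝟙 v * 𝟙 (isEvenFrom x₁ W)) ℚ.+ δ ℚ.* toℚ (𝟙 v)
      by-validity false _ = ℚP.≤-reflexive (begin
        weightedSum (λ w → + 0 * signProduct G w S) (allSignings G) ≡⟨ weightedSum-* (+ 0) (λ w → signProduct G w S) (allSignings G) ⟩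
        0ℚ ℚ.* E                                                   ≡⟨ ℚP.*-zeroˡ E ⟩
        0ℚ                                                         ≡⟨ sym (ℚP.*-zeroʳ δ) ⟩
        δ ℚ.* 0ℚ                                                   ≡⟨ sym (ℚP.+-identityˡ _) ⟩
        0ℚ ℚ.+ δ ℚ.* 0ℚ                                            ∎)
        where
        open ≡-Reasoning
        E = weightedSum (λ w → signProduct G w S) (allSignings G)
      by-validity true valid with validPath⇒hike x₀ x₁ u z as valid
      ... | adj-yz , hike , path-adj = begin
        weightedSum (λ w → + 1 * signProduct G w S) (allSignings G)
          ≡⟨ weightedSum-cong (λ w → trans (ℤP.*-identityˡ _) (signProduct≡prodOver w S path-adj)) (allSignings G) ⟩
        weightedSum (prodOver G (oddEdges S)) (allSignings G)
          ≤⟨ prodOver-bound (oddEdges S) few-odd (δ-nonneg _ _ adj-yz) ⟩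
        toℚ (𝟙 (∣ oddEdges S ∣ ≡ᵇ 0)) ℚ.+ δ
          ≤⟨ ℚP.+-monoˡ-≤ δ (toℚ-mono-≤ (empty≤even (∣ oddEdges S ∣) refl)) ⟩
        toℚ (𝟙 (isEvenFrom x₁ W)) ℚ.+ δ
          ≡⟨ cong₂ (λ a b → toℚ a ℚ.+ b) (sym (ℤP.*-identityˡ (𝟙 (isEvenFrom x₁ W)))) (sym (ℚP.*-identityʳ δ)) ⟩
        toℚ (+ 1 * 𝟙 (isEvenFrom x₁ W)) ℚ.+ δ ℚ.* toℚ (+ 1) ∎
        where
        open ℚP.≤-Reasoning
        few-odd : ∣ oddEdges S ∣ ℕ.≤ 2 ℕ.* suc m
        few-odd = ℕP.≤-trans (∣oddEdges∣≤length S path-adj) (ℕP.≤-reflexive (length-pathSteps (x₀ , x₁) bs as))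
        walk-adj : allAdjacent (steps (x₁ ∷ W)) ≡ true
        walk-adj = proj₁ (∧-true⁻ (proj₂ (∧-true⁻ {x₁ == lastFrom x₁ W} hike)))
        empty≤even : ∀ c → ∣ oddEdges S ∣ ≡ c → 𝟙 (c ≡ᵇ 0) ≤ 𝟙 (isEvenFrom x₁ W)
        empty≤even zero none
          rewrite isEvenFrom-intro x₁ W S walk-adj (pathSteps-parity x₀ x₁ u z as) (oddEdges-empty S none) = ℤP.≤-refl
        empty≤even (suc c) _ = 𝟙-nonneg _

  countᵇ≡sumList : ∀ {A : Set} (P : A → Bool) xs → + countᵇ P xs ≡ sumList (L.map (𝟙 ∘ P) xs)
  countᵇ≡sumList P [] = refl
  countᵇ≡sumList P (x ∷ xs) with P x
  ... | true = cong (_+_ (+ 1)) (countᵇ≡sumList P xs)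
  ... | false = trans (countᵇ≡sumList P xs) (sym (ℤP.+-identityˡ _))

  countᵇ-allVecs : ∀ {n} k (P : Vec (Fin n) k → Bool) → + countᵇ P (allVecs (L.allFin n) k) ≡ ∑Seq k (𝟙 ∘ P)
  countᵇ-allVecs {n} zero P = trans (countᵇ≡sumList P (allVecs (L.allFin n) zero)) (ℤP.+-identityʳ _)
  countᵇ-allVecs {n} (suc k) P = begin
    + countᵇ P (allVecs (L.allFin n) (suc k))
      ≡⟨ countᵇ≡sumList P (allVecs (L.allFin n) (suc k)) ⟩
    sumList (L.map (𝟙 ∘ P) (L.concatMap (λ x → L.map (x ∷_) Vs) (L.allFin n)))
      ≡⟨ sumList-concatMap (𝟙 ∘ P) _ (L.allFin n) ⟩
    sumList (L.map (λ x → sumList (L.map (𝟙 ∘ P) (L.map (x ∷_) Vs))) (L.allFin n))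
      ≡⟨ sumList-allFin (λ x → sumList (L.map (𝟙 ∘ P) (L.map (x ∷_) Vs))) ⟩
    ∑ (λ x → sumList (L.map (𝟙 ∘ P) (L.map (x ∷_) Vs)))
      ≡⟨ ∑-cong (λ x → trans (sumList-map (𝟙 ∘ P) (x ∷_) Vs)
                             (trans (sym (countᵇ≡sumList (P ∘ (x ∷_)) Vs)) (countᵇ-allVecs k (P ∘ (x ∷_))))) ⟩
    ∑Seq (suc k) (𝟙 ∘ P) ∎
    where
    open ≡-Reasoning
    Vs = allVecs (L.allFin n) k

  degree≡∑ : ∀ {n} (G : Graph n) u → + degree G u ≡ ∑ (λ v → 𝟙 (adj G u v))
  degree≡∑ {n} G u = trans (countᵇ≡sumList (adj G u) (L.allFin n)) (sumList-allFin (𝟙 ∘ adj G u))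

  ∑Seq-split : ∀ {n} m (g : List (Fin n) → ℤ) →
    ∑Seq m (λ u → ∑Seq m (λ v → g (V.toList u ++ V.toList v))) ≡ ∑Seq (2 ℕ.* m) (g ∘ V.toList)
  ∑Seq-split m g = sym (begin
    ∑Seq (2 ℕ.* m) (g ∘ V.toList)   ≡⟨ length-cong (cong (m ℕ.+_) (ℕP.+-identityʳ m)) ⟩
    ∑Seq (m ℕ.+ m) (g ∘ V.toList)   ≡⟨ ∑Seq-++ m m (g ∘ V.toList) ⟩
    ∑Seq m (λ u → ∑Seq m (λ v → g (V.toList (u V.++ v))))
      ≡⟨ ∑Seq-cong m (λ u → ∑Seq-cong m (λ v → cong g (VP.toList-++ u v))) ⟩
    ∑Seq m (λ u → ∑Seq m (λ v → g (V.toList u ++ V.toList v))) ∎)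
    where
    open ≡-Reasoning
    length-cong : ∀ {a b} → a ≡ b → ∑Seq a (g ∘ V.toList) ≡ ∑Seq b (g ∘ V.toList)
    length-cong refl = refl

  module Counting {n} (G : Graph n) (d : ℕ) (regular : Regular G d) where
    open Parity G
    open Hikes G

    ∑-adjʳ : ∀ u → ∑ (λ v → 𝟙 (adj G u v)) ≡ + d
    ∑-adjʳ u = trans (sym (degree≡∑ G u)) (cong +_ (regular u))

    ∑-adjˡ : ∀ u → ∑ (λ v → 𝟙 (adj G v u)) ≡ + d
    ∑-adjˡ u = trans (∑-cong (λ v → cong 𝟙 (Graph.sym G v u))) (∑-adjʳ u)

    numEvenHikes≡∑ : ∀ m → + numEvenHikes G m
      ≡ ∑ (λ x → ∑Seq (2 ℕ.* m) (λ v → 𝟙 (isHikeFrom m x (V.toList v) ∧ isEvenFrom x (V.toList v))))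
    numEvenHikes≡∑ m =
      trans (countᵇ-allVecs (suc (2 ℕ.* m)) (λ v → isHike G m v ∧ isEvenWalk m v))
            (∑-cong λ x → ∑Seq-cong (2 ℕ.* m) λ v →
               cong (λ l → 𝟙 (hike x v l ∧ isEvenWalk m (x ∷ v))) (last≡lastFrom x v))
      where
      hike : ∀ x (v : Vec (Fin n) (2 ℕ.* m)) → Fin n → Bool
      hike x v l = (x == l) ∧ (allAdjacent (steps (x ∷ V.toList v)) ∧ nbExcept m 1 (steps (x ∷ V.toList v)))

    ∑-walks : ∀ k x → ∑Seq k (λ v → 𝟙 (allAdjacent (steps (x ∷ V.toList v)))) ≡ + (d ℕ.^ k)
    ∑-walks zero x = refl
    ∑-walks (suc k) x = begin
      ∑ (λ y → ∑Seq k (λ v → 𝟙 (adj G x y ∧ walk y v)))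
        ≡⟨ ∑-cong (λ y → trans (∑Seq-cong k (λ v → 𝟙-∧ (adj G x y) _)) (∑Seq-*ˡ k (𝟙 (adj G x y)) (𝟙 ∘ walk y))) ⟩
      ∑ (λ y → 𝟙 (adj G x y) * ∑Seq k (𝟙 ∘ walk y))
        ≡⟨ ∑-cong (λ y → cong (𝟙 (adj G x y) *_) (∑-walks k y)) ⟩
      ∑ (λ y → 𝟙 (adj G x y) * + (d ℕ.^ k))
        ≡⟨ ∑-*ʳ (+ (d ℕ.^ k)) (λ y → 𝟙 (adj G x y)) ⟩
      ∑ (λ y → 𝟙 (adj G x y)) * + (d ℕ.^ k)
        ≡⟨ cong (_* + (d ℕ.^ k)) (∑-adjʳ x) ⟩
      + d * + (d ℕ.^ k)
        ≡⟨ sym (ℤP.pos-* d (d ℕ.^ k)) ⟩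
      + (d ℕ.^ suc k) ∎
      where
      open ≡-Reasoning
      walk : Fin n → Vec (Fin n) k → Bool
      walk y v = allAdjacent (steps (y ∷ V.toList v))

    -- A path is indexed by an arc (a , b), a forward walk u from b, the detour vertex z,
    -- and a backward walk as; this sums F over all of them with a ~ b.
    ∑Paths : (m : ℕ) → (Fin n → Fin n → Vec (Fin n) m → Fin n → Vec (Fin n) m → ℤ) → ℤ
    ∑Paths m F = ∑ (λ a → ∑ (λ b → 𝟙 (adj G a b) * ∑Seq m (λ u → ∑ (λ z → ∑Seq m (F a b u z)))))

    ∑Paths-mono-≤ : ∀ m {F F′} → (∀ a b u z as → F a b u z as ≤ F′ a b u z as) → ∑Paths m F ≤ ∑Paths m F′
    ∑Paths-mono-≤ m h =
      ∑-mono-≤ (λ a → ∑-mono-≤ (λ b → 𝟙*-mono-≤ (adj G a b)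
        (∑Seq-mono-≤ m (λ u → ∑-mono-≤ (λ z → ∑Seq-mono-≤ m (h a b u z))))))

    -- Both a (a neighbour of b) and z (a neighbour of the last vertex of u) range over d choices.
    ∑Paths-detour : ∀ m (g : Fin n → List (Fin n) → Bool) →
      ∑Paths m (λ a b u z as → 𝟙 (adj G (lastFrom b (V.toList u)) z) * 𝟙 (g b (V.toList u ++ V.toList as)))
        ≡ + d * (+ d * ∑ (λ b → ∑Seq (2 ℕ.* m) (𝟙 ∘ g b ∘ V.toList)))
    ∑Paths-detour m g = begin
      ∑ (λ a → ∑ (λ b → 𝟙 (adj G a b) * ∑Seq m (λ u → ∑ (λ z → ∑Seq m (λ as → 𝟙 (adj G (last b u) z) * Q b u as)))))
        ≡⟨ ∑-cong (λ a → ∑-cong (λ b → cong (𝟙 (adj G a b) *_) (trans (∑Seq-cong m (detour b)) (∑Seq-*ˡ m (+ d) _)))) ⟩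
      ∑ (λ a → ∑ (λ b → 𝟙 (adj G a b) * (+ d * R b)))
        ≡⟨ ∑-comm (λ a b → 𝟙 (adj G a b) * (+ d * R b)) ⟩
      ∑ (λ b → ∑ (λ a → 𝟙 (adj G a b) * (+ d * R b)))
        ≡⟨ ∑-cong (λ b → trans (∑-*ʳ (+ d * R b) (λ a → 𝟙 (adj G a b))) (cong (_* (+ d * R b)) (∑-adjˡ b))) ⟩
      ∑ (λ b → + d * (+ d * R b))
        ≡⟨ trans (∑-*ˡ (+ d) (λ b → + d * R b)) (cong (+ d *_) (∑-*ˡ (+ d) R)) ⟩
      + d * (+ d * ∑ R)
        ≡⟨ cong (λ x → + d * (+ d * x)) (∑-cong (λ b → ∑Seq-split m (𝟙 ∘ g b))) ⟩
      + d * (+ d * ∑ (λ b → ∑Seq (2 ℕ.* m) (𝟙 ∘ g b ∘ V.toList))) ∎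
      where
      open ≡-Reasoning
      last : Fin n → Vec (Fin n) m → Fin n
      last b u = lastFrom b (V.toList u)
      Q : Fin n → Vec (Fin n) m → Vec (Fin n) m → ℤ
      Q b u as = 𝟙 (g b (V.toList u ++ V.toList as))
      R : Fin n → ℤ
      R b = ∑Seq m (λ u → ∑Seq m (Q b u))
      detour : ∀ b u → ∑ (λ z → ∑Seq m (λ as → 𝟙 (adj G (last b u) z) * Q b u as)) ≡ + d * ∑Seq m (Q b u)
      detour b u = begin
        ∑ (λ z → ∑Seq m (λ as → 𝟙 (adj G (last b u) z) * Q b u as))
          ≡⟨ ∑-cong (λ z → ∑Seq-*ˡ m (𝟙 (adj G (last b u) z)) (Q b u)) ⟩
        ∑ (λ z → 𝟙 (adj G (last b u) z) * ∑Seq m (Q b u))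
          ≡⟨ ∑-*ʳ (∑Seq m (Q b u)) (λ z → 𝟙 (adj G (last b u) z)) ⟩
        ∑ (λ z → 𝟙 (adj G (last b u) z)) * ∑Seq m (Q b u)
          ≡⟨ cong (_* ∑Seq m (Q b u)) (∑-adjʳ (last b u)) ⟩
        + d * ∑Seq m (Q b u) ∎

  module TraceBound {n} (G : Graph n) (d : ℕ) (regular : Regular G d) (m : ℕ) (p : Signing G → ℚ) (δ : ℚ)
                    (dist : IsDistribution G p) (wise : WiseUniform G p δ (2 ℕ.* suc m)) where
    open WeightedSum p
    open ExpBounds δ (allSignings G)
    open PathBound G p δ m dist wise
    open Parity G
    open Hikes G
    open Counting G d regular

    ExpBound-∑Seq : ∀ k (f : Vec (Fin n) k → Signing G → ℤ) a b → (∀ v → ExpBound (f v) (a v) (b v)) →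
      ExpBound (λ w → ∑Seq k (λ v → f v w)) (∑Seq k a) (∑Seq k b)
    ExpBound-∑Seq zero f a b h = h []
    ExpBound-∑Seq (suc k) f a b h =
      ExpBound-∑ (λ x w → ∑Seq k (λ v → f (x ∷ v) w)) (λ x → ∑Seq k (a ∘ (x ∷_))) (λ x → ∑Seq k (b ∘ (x ∷_)))
                 (λ x → ExpBound-∑Seq k (f ∘ (x ∷_)) (a ∘ (x ∷_)) (b ∘ (x ∷_)) (h ∘ (x ∷_)))

    ExpBound-∑Paths : ∀ (F : Fin n → Fin n → Vec (Fin n) m → Fin n → Vec (Fin n) m → Signing G → ℤ) α β →
      (∀ a b u z as → ExpBound (F a b u z as) (α a b u z as) (β a b u z as)) →
      ExpBound (λ w → ∑Paths m (λ a b u z as → F a b u z as w)) (∑Paths m α) (∑Paths m β)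
    ExpBound-∑Paths F α β h =
      ExpBound-∑ _ _ _ λ a → ExpBound-∑ _ _ _ λ b → ExpBound-scale (𝟙 (adj G a b)) _ _ _ (𝟙-nonneg _)
        (ExpBound-∑Seq m _ _ _ λ u → ExpBound-∑ _ _ _ λ z → ExpBound-∑Seq m _ _ _ (h a b u z))

    valid : Fin n → Fin n → Vec (Fin n) m → Fin n → Vec (Fin n) m → Bool
    valid a b u z as = validPath G (a , b) (u V.∷ʳ z) as

    countValidEven countValid : ℤ
    countValidEven = ∑Paths m (λ a b u z as → 𝟙 (valid a b u z as) * 𝟙 (isEvenFrom b (V.toList u ++ V.toList as)))
    countValid = ∑Paths m (λ a b u z as → 𝟙 (valid a b u z as))

    Tval≡∑Paths : ∀ w → Tval G (suc m) w ≡ ∑Paths m (λ a b u z as → pathWeight G w (a , b) (u V.∷ʳ z) as)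
    Tval≡∑Paths w = trans (Tval≡∑edgeTerm G w m) (∑-cong λ a → ∑-cong λ b → cong (𝟙 (adj G a b) *_)
      (trans (edgeTerm≡∑Seq G w m (a , b)) (∑Seq-∷ʳ m (λ bs → ∑Seq m (pathWeight G w (a , b) bs)))))

    Tval-bound : ExpBound (Tval G (suc m)) countValidEven countValid
    Tval-bound = ExpBound-cong {a = countValidEven} {b = countValid} (sym ∘ Tval≡∑Paths)
      (ExpBound-∑Paths _ _ _ pathWeight-bound)

    valid⇒detour-hike : ∀ a b u z as (g : List (Fin n) → Bool) →
      𝟙 (valid a b u z as) * 𝟙 (g (V.toList u ++ V.toList as))
        ≤ 𝟙 (adj G (lastFrom b (V.toList u)) z) * 𝟙 (isHikeFrom m b (V.toList u ++ V.toList as) ∧ g (V.toList u ++ V.toList as))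
    valid⇒detour-hike a b u z as g with valid a b u z as in is-valid
    ... | false = 𝟙*𝟙-nonneg (adj G (lastFrom b (V.toList u)) z) (isHikeFrom m b (V.toList u ++ V.toList as) ∧ g (V.toList u ++ V.toList as))
    ... | true with validPath⇒hike a b u z as is-valid
    ... | adj-yz , hike , _ rewrite adj-yz | hike = ℤP.≤-refl

    countValidEven≤ : countValidEven ≤ + (d ℕ.^ 2 ℕ.* numEvenHikes G m)
    countValidEven≤ = begin
      countValidEven
        ≤⟨ ∑Paths-mono-≤ m (λ a b u z as → valid⇒detour-hike a b u z as (isEvenFrom b)) ⟩
      ∑Paths m (λ a b u z as → 𝟙 (adj G (lastFrom b (V.toList u)) z) * 𝟙 (evenHike b (V.toList u ++ V.toList as)))
        ≡⟨ ∑Paths-detour m evenHike ⟩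
      + d * (+ d * ∑ (λ b → ∑Seq (2 ℕ.* m) (𝟙 ∘ evenHike b ∘ V.toList)))
        ≡⟨ cong (λ x → + d * (+ d * x)) (sym (numEvenHikes≡∑ m)) ⟩
      + d * (+ d * + numEvenHikes G m)
        ≡⟨ cong (+ d *_) (sym (ℤP.pos-* d _)) ⟩
      + d * + (d ℕ.* numEvenHikes G m)
        ≡⟨ sym (ℤP.pos-* d _) ⟩
      + (d ℕ.* (d ℕ.* numEvenHikes G m))
        ≡⟨ cong +_ (sym (ℕP.*-assoc d d _)) ⟩
      + (d ℕ.* d ℕ.* numEvenHikes G m)
        ≡⟨ cong (λ x → + (x ℕ.* numEvenHikes G m)) (cong (d ℕ.*_) (sym (ℕP.*-identityʳ d))) ⟩
      + (d ℕ.^ 2 ℕ.* numEvenHikes G m) ∎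
      where
      open ℤP.≤-Reasoning
      evenHike : Fin n → List (Fin n) → Bool
      evenHike b W = isHikeFrom m b W ∧ isEvenFrom b W

    N : ℕ
    N = n ℕ.* d ℕ.^ (2 ℕ.* suc m ℕ.+ 2)

    countValid≤ : countValid ≤ + N
    countValid≤ = begin
      countValid
        ≤⟨ ∑Paths-mono-≤ m (λ a b u z as → subst (_≤ _) (ℤP.*-identityʳ _) (valid⇒detour-hike a b u z as (λ _ → true))) ⟩
      ∑Paths m (λ a b u z as → 𝟙 (adj G (lastFrom b (V.toList u)) z) * 𝟙 (hike b (V.toList u ++ V.toList as)))
        ≡⟨ ∑Paths-detour m hike ⟩
      + d * (+ d * ∑ (λ b → ∑Seq (2 ℕ.* m) (𝟙 ∘ hike b ∘ V.toList)))
        ≤⟨ ℤP.*-monoˡ-≤-nonNeg (+ d) (ℤP.*-monoˡ-≤-nonNeg (+ d)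
             (∑-mono-≤ λ b → ∑Seq-mono-≤ (2 ℕ.* m) λ v → hike≤walk b (V.toList v))) ⟩
      + d * (+ d * ∑ (λ b → ∑Seq (2 ℕ.* m) (λ v → 𝟙 (allAdjacent (steps (b ∷ V.toList v))))))
        ≡⟨ cong (λ x → + d * (+ d * x)) (trans (∑-cong (∑-walks (2 ℕ.* m))) (∑-const {n} _)) ⟩
      + d * (+ d * (+ n * + (d ℕ.^ (2 ℕ.* m))))
        ≡⟨ pos-*³ d d n (d ℕ.^ (2 ℕ.* m)) ⟩
      + (d ℕ.* (d ℕ.* (n ℕ.* d ℕ.^ (2 ℕ.* m))))
        ≤⟨ ℤ.+≤+ (ℕP.≤-trans (ℕP.≤-reflexive (regroup d n _)) (ℕP.*-monoʳ-≤ n (^-suc-≤-+2 d (suc (2 ℕ.* m))))) ⟩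
      + (n ℕ.* d ℕ.^ (suc (suc (2 ℕ.* m)) ℕ.+ 2))
        ≡⟨ cong (λ e → + (n ℕ.* d ℕ.^ e)) (exponent m) ⟩
      + N ∎
      where
      open ℤP.≤-Reasoning
      hike : Fin n → List (Fin n) → Bool
      hike b W = isHikeFrom m b W ∧ true
      hike≤walk : ∀ b W → 𝟙 (hike b W) ≤ 𝟙 (allAdjacent (steps (b ∷ W)))
      hike≤walk b W with b == lastFrom b W | allAdjacent (steps (b ∷ W))
      ... | false | c = 𝟙-nonneg c
      ... | true | true = 𝟙≤1 _
      ... | true | false = ℤP.≤-refl
      pos-*³ : ∀ a b c e → + a * (+ b * (+ c * + e)) ≡ + (a ℕ.* (b ℕ.* (c ℕ.* e)))
      pos-*³ a b c e = sym (trans (ℤP.pos-* a _) (cong (+ a *_) (trans (ℤP.pos-* b _) (cong (+ b *_) (ℤP.pos-* c e)))))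
      regroup : ∀ d n x → d ℕ.* (d ℕ.* (n ℕ.* x)) ≡ n ℕ.* (d ℕ.* (d ℕ.* x))
      regroup = ℕ-Solver.solve-∀
      ^-suc-≤-+2 : ∀ d j → d ℕ.^ suc j ℕ.≤ d ℕ.^ (suc j ℕ.+ 2)
      ^-suc-≤-+2 zero j = ℕ.z≤n
      ^-suc-≤-+2 (suc d) j = ℕP.^-monoʳ-≤ (suc d) (ℕP.m≤m+n (suc j) 2)
      exponent : ∀ m → suc (suc (2 ℕ.* m)) ℕ.+ 2 ≡ 2 ℕ.* suc m ℕ.+ 2
      exponent = ℕ-Solver.solve-∀

    -- If δ < 0 then G has no edges (δ ≥ 0 as soon as one edge exists), so both sides vanish.
    δ*countValid≤ : δ ℚ.* toℚ countValid ℚ.≤ δ ℚ.* ℕtoℚ N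
    δ*countValid≤ with δ ℚP.<? 0ℚ
    ... | no δ≮0 = ℚP.*-monoˡ-≤-nonNeg δ {{ℚ.nonNegative (ℚP.≮⇒≥ δ≮0)}} (toℚ-mono-≤ countValid≤)
    ... | yes δ<0 = ℚP.≤-reflexive (cong (λ x → δ ℚ.* toℚ x) (trans countValid≡0 (cong +_ (sym N≡0))))
      where
      no-edge : ∀ a b → adj G a b ≡ false
      no-edge a b with adj G a b in adj-ab
      ... | false = refl
      ... | true = ⊥-elim (ℚP.<-irrefl refl (ℚP.<-≤-trans δ<0 (δ-nonneg a b adj-ab)))
      ∑∑adj≡0 : ∀ (F : Fin n → Fin n → ℤ) → ∑ (λ a → ∑ (λ b → 𝟙 (adj G a b) * F a b)) ≡ + 0
      ∑∑adj≡0 F = trans (∑-cong λ a → trans (∑-cong λ b → cong (λ c → 𝟙 c * F a b) (no-edge a b)) (∑-zero {n}))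
                        (∑-zero {n})
      countValid≡0 : countValid ≡ + 0
      countValid≡0 = ∑∑adj≡0 (λ a b → ∑Seq m (λ u → ∑ (λ z → ∑Seq m (λ as → 𝟙 (valid a b u z as)))))
      nd≡0 : n ℕ.* d ≡ 0
      nd≡0 = ℤP.+-injective (begin
        + (n ℕ.* d)                        ≡⟨ ℤP.pos-* n d ⟩
        + n * + d                          ≡⟨ sym (∑-const {n} (+ d)) ⟩
        ∑ {n} (λ _ → + d)                  ≡⟨ ∑-cong (λ a → sym (∑-adjʳ a)) ⟩
        ∑ (λ a → ∑ (λ b → 𝟙 (adj G a b)))  ≡⟨ ∑-cong (λ a → ∑-cong (λ b → sym (ℤP.*-identityʳ (𝟙 (adj G a b))))) ⟩
        ∑ (λ a → ∑ (λ b → 𝟙 (adj G a b) * + 1)) ≡⟨ ∑∑adj≡0 (λ _ _ → + 1) ⟩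
        + 0                                ∎)
        where open ≡-Reasoning
      N≡0 : N ≡ 0
      N≡0 with ℕP.m*n≡0⇒m≡0∨n≡0 n nd≡0
      ... | inj₁ refl = refl
      ... | inj₂ refl = ℕP.*-zeroʳ n

    𝔼Tval≤ : 𝔼 G p (Tval G (suc m)) ℚ.≤ ℕtoℚ (d ℕ.^ 2 ℕ.* numEvenHikes G m) ℚ.+ δ ℚ.* ℕtoℚ N
    𝔼Tval≤ = ℚP.≤-trans Tval-bound (ℚP.+-mono-≤ (toℚ-mono-≤ countValidEven≤) δ*countValid≤)

  -- The uniform signing

  length-allVecs : ∀ k → L.length (allVecs (true ∷ false ∷ []) k) ≡ 2 ℕ.^ k
  length-allVecs zero = refl
  length-allVecs (suc k) = begin
    L.length (L.map (true ∷_) Vs ++ (L.map (false ∷_) Vs ++ []))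
      ≡⟨ LP.length-++ (L.map (true ∷_) Vs) ⟩
    L.length (L.map (true ∷_) Vs) ℕ.+ L.length (L.map (false ∷_) Vs ++ [])
      ≡⟨ cong₂ ℕ._+_ (LP.length-map (true ∷_) Vs) (trans (LP.length-++ (L.map (false ∷_) Vs))
                     (trans (ℕP.+-identityʳ _) (LP.length-map (false ∷_) Vs))) ⟩
    L.length Vs ℕ.+ L.length Vs
      ≡⟨ cong₂ ℕ._+_ (length-allVecs k) (trans (length-allVecs k) (sym (ℕP.+-identityʳ _))) ⟩
    2 ℕ.^ suc k ∎
    where
    open ≡-Reasoning
    Vs = allVecs (true ∷ false ∷ []) k

  sumℚ-const : ∀ {A : Set} (c : ℚ) (xs : List A) → sumℚ (L.map (λ _ → c) xs) ≡ toℚ (+ L.length xs) ℚ.* c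
  sumℚ-const c [] = sym (ℚP.*-zeroˡ c)
  sumℚ-const c (x ∷ xs) = begin
    c ℚ.+ sumℚ (L.map (λ _ → c) xs)             ≡⟨ cong (c ℚ.+_) (sumℚ-const c xs) ⟩
    c ℚ.+ toℚ (+ L.length xs) ℚ.* c             ≡⟨ cong (ℚ._+ toℚ (+ L.length xs) ℚ.* c) (sym (ℚP.*-identityˡ c)) ⟩
    1ℚ ℚ.* c ℚ.+ toℚ (+ L.length xs) ℚ.* c      ≡⟨ sym (ℚP.*-distribʳ-+ c 1ℚ (toℚ (+ L.length xs))) ⟩
    (1ℚ ℚ.+ toℚ (+ L.length xs)) ℚ.* c          ≡⟨ cong (ℚ._* c) (sym (toℚ-+ (+ 1) (+ L.length xs))) ⟩
    toℚ (+ L.length (x ∷ xs)) ℚ.* c             ∎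
    where open ≡-Reasoning

  toℚ-*-inverse : ∀ k .{{_ : ℕ.NonZero k}} → toℚ (+ k) ℚ.* (+ 1 ℚ./ k) ≡ 1ℚ
  toℚ-*-inverse (suc k) = ℚP.toℚᵘ-injective (ℚᵘP.≃-trans (ℚP.toℚᵘ-homo-* (toℚ (+ suc k)) (+ 1 ℚ./ suc k)) viaᵘ)
    where
    inverseᵘ : ℚ.toℚᵘ (+ 1 ℚ./ suc k) ≡ ℚᵘ.mkℚᵘ (+ 1) k
    inverseᵘ rewrite ℚP.normalize-coprime {1} {k} (Cop.1-coprimeTo (suc k)) = refl
    identity : (+ suc k * + 1) * + 1 ≡ + 1 * + (1 ℕ.* suc k)
    identity = trans (ℤP.*-identityʳ _) (trans (ℤP.*-identityʳ _)
                 (sym (trans (ℤP.*-identityˡ _) (cong +_ (ℕP.*-identityˡ (suc k))))))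
    viaᵘ : (ℚ.toℚᵘ (toℚ (+ suc k)) ℚᵘ.* ℚ.toℚᵘ (+ 1 ℚ./ suc k)) ℚᵘ.≃ ℚ.toℚᵘ 1ℚ
    viaᵘ rewrite toℚᵘ-toℚ (+ suc k) | inverseᵘ = ℚᵘ.*≡* identity

  sumList-* : ∀ {A : Set} (a : ℤ) (g : A → ℤ) xs → sumList (L.map (λ w → a * g w) xs) ≡ a * sumList (L.map g xs)
  sumList-* a g [] = sym (ℤP.*-zeroʳ a)
  sumList-* a g (x ∷ xs) = trans (cong (_+_ (a * g x)) (sumList-* a g xs)) (sym (ℤP.*-distribˡ-+ a (g x) _))

  signProductOn : ∀ {k} → Subset k → Vec Bool k → ℤ
  signProductOn S w = ∏ (λ e → if V.lookup S e then sgn (V.lookup w e) else + 1)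

  -- Flipping the sign of a coordinate in S pairs off the sign vectors with opposite products.
  ∑-signProductOn≡0 : ∀ k (S : Subset k) → 1 ℕ.≤ ∣ S ∣ →
    sumList (L.map (signProductOn S) (allVecs (true ∷ false ∷ []) k)) ≡ + 0
  ∑-signProductOn≡0 (suc k) (s ∷ S) nonempty = begin
    sumList (L.map (signProductOn (s ∷ S)) (L.map (true ∷_) Vs ++ (L.map (false ∷_) Vs ++ [])))
      ≡⟨ trans (sumList-++ _ (L.map (true ∷_) Vs) _) (cong (_+_ (Σ⁺)) (sumList-++ _ (L.map (false ∷_) Vs) [])) ⟩
    Σ⁺ + (Σ⁻ + + 0)
      ≡⟨ cong₂ (λ x y → x + (y + + 0)) (trans (sumList-map _ (true ∷_) Vs) (sumList-* (if s then + 1 else + 1) _ Vs))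
                                         (trans (sumList-map _ (false ∷_) Vs) (sumList-* (if s then -[1+ 0 ] else + 1) _ Vs)) ⟩
    (if s then + 1 else + 1) * T + ((if s then -[1+ 0 ] else + 1) * T + + 0)
      ≡⟨ cancel s nonempty ⟩
    + 0 ∎
    where
    open ≡-Reasoning
    Vs = allVecs (true ∷ false ∷ []) k
    T = sumList (L.map (signProductOn S) Vs)
    Σ⁺ = sumList (L.map (signProductOn (s ∷ S)) (L.map (true ∷_) Vs))
    Σ⁻ = sumList (L.map (signProductOn (s ∷ S)) (L.map (false ∷_) Vs))
    cancel : ∀ s → 1 ℕ.≤ ∣ s ∷ S ∣ → (if s then + 1 else + 1) * T + ((if s then -[1+ 0 ] else + 1) * T + + 0) ≡ + 0
    cancel true _ = opposite T
      where
      opposite : ∀ (x : ℤ) → + 1 * x + (-[1+ 0 ] * x + + 0) ≡ + 0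
      opposite = solve-∀
    cancel false nonempty rewrite ∑-signProductOn≡0 k S nonempty = refl

  module Uniform {n} (G : Graph n) where
    open WeightedSum (uniform G)

    mass : ℚ
    mass = uniform G (V.replicate (numEdges G) true)

    uniform-isDistribution : IsDistribution G (uniform G)
    uniform-isDistribution = nonNeg , total
      where
      instance
        2^|E|≢0 : ℕ.NonZero (2 ℕ.^ numEdges G)
        2^|E|≢0 = ℕP.m^n≢0 2 (numEdges G)
      nonNeg : ∀ w → 0ℚ ℚ.≤ uniform G w
      nonNeg w = ℚP.nonNegative⁻¹ (uniform G w) {{ℚP.normalize-nonNeg 1 (2 ℕ.^ numEdges G)}}
      total : sumℚ (L.map (uniform G) (allSignings G)) ≡ 1ℚ
      total = begin
        sumℚ (L.map (λ _ → mass) (allSignings G))         ≡⟨ sumℚ-const mass (allSignings G) ⟩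
        toℚ (+ L.length (allSignings G)) ℚ.* mass          ≡⟨ cong (λ k → toℚ (+ k) ℚ.* mass) (length-allVecs (numEdges G)) ⟩
        toℚ (+ (2 ℕ.^ numEdges G)) ℚ.* mass                ≡⟨ toℚ-*-inverse (2 ℕ.^ numEdges G) ⟩
        1ℚ                                                 ∎
        where open ≡-Reasoning

    weightedSum-uniform : ∀ (f : Signing G → ℤ) ws → weightedSum f ws ≡ mass ℚ.* toℚ (sumList (L.map f ws))
    weightedSum-uniform f [] = sym (ℚP.*-zeroʳ mass)
    weightedSum-uniform f (w ∷ ws) =
      trans (cong (mass ℚ.* toℚ (f w) ℚ.+_) (weightedSum-uniform f ws))
            (trans (sym (ℚP.*-distribˡ-+ mass _ _)) (cong (mass ℚ.*_) (sym (toℚ-+ (f w) _))))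

    uniform-wiseUniform : ∀ k → WiseUniform G (uniform G) 0ℚ k
    uniform-wiseUniform k S nonempty _ = ℚP.≤-reflexive (cong ℚ.∣_∣ (begin
      weightedSum (prodOver G S) (allSignings G)
        ≡⟨ weightedSum-uniform (prodOver G S) (allSignings G) ⟩
      mass ℚ.* toℚ (sumList (L.map (prodOver G S) (allSignings G)))
        ≡⟨ cong (λ z → mass ℚ.* toℚ z) (∑-signProductOn≡0 (numEdges G) S nonempty) ⟩
      mass ℚ.* 0ℚ
        ≡⟨ ℚP.*-zeroʳ mass ⟩
      0ℚ ∎))
      where open ≡-Reasoning

  -- Even hikes are singleton-free

  countᵇ-mono : ∀ {A : Set} (P Q : A → Bool) → (∀ x → P x ≡ true → Q x ≡ true) → ∀ xs → countᵇ P xs ℕ.≤ countᵇ Q xs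
  countᵇ-mono P Q P⇒Q [] = ℕ.z≤n
  countᵇ-mono P Q P⇒Q (x ∷ xs) with P x in px | Q x in qx
  ... | true | true = ℕ.s≤s (countᵇ-mono P Q P⇒Q xs)
  ... | false | true = ℕP.m≤n⇒m≤1+n (countᵇ-mono P Q P⇒Q xs)
  ... | false | false = countᵇ-mono P Q P⇒Q xs
  ... | true | false with trans (sym (P⇒Q x px)) qx
  ... | ()

  allᵇ-mono : ∀ {A : Set} (P Q : A → Bool) → (∀ x → P x ≡ true → Q x ≡ true) →
    ∀ xs → allᵇ P xs ≡ true → allᵇ Q xs ≡ true
  allᵇ-mono P Q P⇒Q [] _ = refl
  allᵇ-mono P Q P⇒Q (x ∷ xs) h =
    let px , pxs = ∧-true⁻ {P x} h in ∧-true⁺ (P⇒Q x px) (allᵇ-mono P Q P⇒Q xs pxs)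

  isEvenℕ⇒≢1 : ∀ t → isEvenℕ t ≡ true → not (t ≡ᵇ 1) ≡ true
  isEvenℕ⇒≢1 0 _ = refl
  isEvenℕ⇒≢1 (suc (suc t)) _ = refl

  numEvenHikes≤numSingletonFreeHikes : ∀ {n} (G : Graph n) m → numEvenHikes G m ℕ.≤ numSingletonFreeHikes G m
  numEvenHikes≤numSingletonFreeHikes {n} G m = countᵇ-mono _ _ even⇒singletonFree (allWalks n m)
    where
    even⇒singletonFree : ∀ v → (isHike G m v ∧ isEvenWalk m v) ≡ true → (isHike G m v ∧ isSingletonFreeWalk m v) ≡ true
    even⇒singletonFree v h =
      let hike , even = ∧-true⁻ {isHike G m v} h
          count : Fin n × Fin n → ℕ
          count ab = traversals (proj₁ ab) (proj₂ ab) (steps (V.toList v))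
      in ∧-true⁺ hike (allᵇ-mono (isEvenℕ ∘ count) (λ ab → not (count ab ≡ᵇ 1)) (isEvenℕ⇒≢1 ∘ count) (allPairs n) even)

open import Defs
open import Data.Nat using (ℕ; _≤_; _*_; _^_; _∸_; _+_)
open import Data.Rational using (ℚ) renaming (_≤_ to _≤ℚ_; _+_ to _+ℚ_; _*_ to _*ℚ_)
open import Data.Product using (_×_; _,_)
import Data.Nat as ℕ
import Data.Nat.Properties as ℕP
import Data.Integer as ℤ
import Data.Rational as ℚ
import Data.Rational.Properties as ℚP
open import Relation.Binary.PropositionalEquality using (cong; trans)
open NonBacktrackingTrace

proposition3p3 : ∀ {n} (G : Graph n) (d ℓ : ℕ) → Regular G d → 1 ≤ ℓ →
    ((𝔼 G (uniform G) (Tval G ℓ) ≤ℚ ℕtoℚ (d ^ 2 * numEvenHikes G (ℓ ∸ 1)))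
      × (ℕtoℚ (d ^ 2 * numEvenHikes G (ℓ ∸ 1)) ≤ℚ ℕtoℚ (d ^ 2 * numSingletonFreeHikes G (ℓ ∸ 1))))
    × (∀ (δ : ℚ) (p : Signing G → ℚ) → IsDistribution G p → WiseUniform G p δ (2 * ℓ) →
        (𝔼 G p (Tval G ℓ) ≤ℚ ℕtoℚ (d ^ 2 * numEvenHikes G (ℓ ∸ 1)) +ℚ δ *ℚ ℕtoℚ (n * d ^ (2 * ℓ + 2)))
        × (ℕtoℚ (d ^ 2 * numEvenHikes G (ℓ ∸ 1)) +ℚ δ *ℚ ℕtoℚ (n * d ^ (2 * ℓ + 2))
            ≤ℚ ℕtoℚ (d ^ 2 * numSingletonFreeHikes G (ℓ ∸ 1)) +ℚ δ *ℚ ℕtoℚ (n * d ^ (2 * ℓ + 2))))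
proposition3p3 {n} G d (ℕ.suc m) regular (ℕ.s≤s ℕ.z≤n) =
  (uniform-bound , even≤singletonFree) ,
  λ δ p dist wise → TraceBound.𝔼Tval≤ G d regular m p δ dist wise , ℚP.+-monoˡ-≤ _ even≤singletonFree
  where
  even≤singletonFree : ℕtoℚ (d ^ 2 * numEvenHikes G m) ≤ℚ ℕtoℚ (d ^ 2 * numSingletonFreeHikes G m)
  even≤singletonFree = toℚ-mono-≤ (ℤ.+≤+ (ℕP.*-monoʳ-≤ (d ^ 2) (numEvenHikes≤numSingletonFreeHikes G m)))
  uniform-bound : 𝔼 G (uniform G) (Tval G (ℕ.suc m)) ≤ℚ ℕtoℚ (d ^ 2 * numEvenHikes G m)
  uniform-bound = ℚP.≤-trans
    (TraceBound.𝔼Tval≤ G d regular m (uniform G) ℚ.0ℚ (Uniform.uniform-isDistribution G) (Uniform.uniform-wiseUniform G _))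
    (ℚP.≤-reflexive (trans (cong (ℕtoℚ (d ^ 2 * numEvenHikes G m) +ℚ_) (ℚP.*-zeroˡ (ℕtoℚ (n * d ^ (2 * ℕ.suc m + 2))))) (ℚP.+-identityʳ _)))
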